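{- Let $k\ge 2$, $t=k+2$, and let $n$ be a positive multiple of $k$. Let $T$ be a $k$-color valid $t$-gonal tiling of points $p_1,\ldots,p_{n+2}$ in convex position, and let $e=p_rp_{r+1}$ with $1\le r\le n+1$. Then $T$ can be extended by an ear at $e$ (that is, $k$ new points are inserted in convex position between $p_r$ and $p_{r+1}$, the points are relabeled clockwise starting from $p_1$, and a new $t$-gonal face with vertices $p_r$, the $k$ new points, and $p_{r+1}$ is added, $e$ becoming an interior edge) such that the resulting $t$-gonal tiling on $n+k+2$ points is $k$-color valid.
   Context: A triangulation of points in convex position is a maximal plane straight-line graph on them. For $t\ge3$, a $t$-gonal tiling of $N+2$ points $p_1,\ldots,p_{N+2}$ in convex position (labeled clockwise) is a plane straight-line graph on them in which every bounded face is a $t$-gon and the vertices along the unbounded face are $p_1,\ldots,p_{N+2}$ in this order. Outdegree sequence of a triangulation $\mathcal T$ of $p_1,\ldots,p_{N+2}$: for $1\le i\le N$, $d_i$ is the number of edges $p_ip_j$ of $\mathcal T$ with $j>i$ that are not convex hull edges, except that the hull edge $p_1p_{N+2}$ is counted (for $p_1$). From $(d_1,\ldots,d_N)$ form the $0/1$-sequence $(b_1,\ldots,b_{2N})$ by writing, for $i=1,\ldots,N$ in order, $d_i$ ones followed by one zero. On points $v_1,\ldots,v_{2N}$ in convex position (clockwise) build a matching by scanning $j=1,\ldots,2N$ with a stack: if $b_j=1$ push $j$; if $b_j=0$ pop the top index $\ell$ and add edge $v_\ell v_j$. This yields a plane perfect matching $M(\mathcal T)$ (and this is a bijection between triangulations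 and plane perfect matchings). Coloring: for $N$ a multiple of $k$, the vertices are split into blocks $\{v_{(i-1)k+1},\ldots,v_{ik}\}$ and $v_{(i-1)k+r}$ ($1\le r\le k$) gets color $c_r$ if $i$ is odd and $c_{k+1-r}$ if $i$ is even. A triangulation $\mathcal T$ is $k$-color valid if every edge of $M(\mathcal T)$ joins two vertices of the same color. A $t$-gonal tiling is $k$-color valid if it is a subgraph of (all its edges belong to) some $k$-color valid triangulation of the same point set. -}

module Defs where

open import Data.Nat using (ℕ; zero; suc; _+_; _*_; _∸_; _≤_; _<_; _≟_)
open import Data.Nat.DivMod using (_/_; _%_)
open import Data.Nat.Properties using ()
open import Data.Bool using (Bool; true; false; if_then_else_)
open import Data.Nat using (_≤ᵇ_)
open import Data.List using (List; []; _∷_; _++_; map; length; filter; upTo; concatMap; replicate)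
open import Data.List.Membership.Propositional using (_∈_)
import Data.List.Membership.DecPropositional as DecMem
open import Data.List.Relation.Unary.All using (All)
open import Data.Product using (_×_; _,_; proj₁; proj₂; ∃)
open import Data.Product.Properties using (≡-dec)
open import Data.Sum using (_⊎_)
open import Relation.Nullary using (¬_; Dec)
open import Relation.Nullary.Decidable using (_⊎-dec_)
open import Relation.Binary.PropositionalEquality using (_≡_; _≢_)

-- Points p_1,…,p_M in convex position are identified with the labels
-- 1,…,M (clockwise).  Since the points are in convex position, a plane
-- straight-line graph on them is determined combinatorially: a list of
-- edges (pairs of labels), two edges crossing iff their endpoints
-- interleave.

Graph : Set
Graph = List (ℕ × ℕ)

Adj : Graph → ℕ → ℕ → Set
Adj G i j = (i , j) ∈ G ⊎ (j , i) ∈ G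

_∈?ₑ_ : (e : ℕ × ℕ) → (G : Graph) → Dec (e ∈ G)
_∈?ₑ_ = DecMem._∈?_ (≡-dec _≟_ _≟_)

Adj? : (G : Graph) → (i j : ℕ) → Dec (Adj G i j)
Adj? G i j = ((i , j) ∈?ₑ G) ⊎-dec ((j , i) ∈?ₑ G)

ValidEdges : ℕ → Graph → Set
ValidEdges M G =
  All (λ e → 1 ≤ proj₁ e × proj₁ e ≤ M × 1 ≤ proj₂ e × proj₂ e ≤ M × proj₁ e ≢ proj₂ e) G

-- the segments p_a p_b and p_c p_d (a<b, c<d) cross in their interiors
Cross : ℕ → ℕ → ℕ → ℕ → Set
Cross a b c d = a < c × c < b × b < d

-- plane: no two edges cross (Adj is symmetric, so all orientations are covered)
Plane : Graph → Set
Plane G = ∀ a b c d → Adj G a b → Adj G c d → ¬ Cross a b c d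

PlaneGraph : ℕ → Graph → Set
PlaneGraph M G = ValidEdges M G × Plane G

Maximal : ℕ → Graph → Set
Maximal M G = ∀ i j → 1 ≤ i → i < j → j ≤ M →
  (∀ c d → Adj G c d → ¬ Cross i j c d × ¬ Cross c d i j) → Adj G i j

Triangulation : ℕ → Graph → Set
Triangulation M G = PlaneGraph M G × Maximal M G

-- the convex hull edges p_i p_{i+1} and p_M p_1 are present, so the
-- unbounded face has vertices p_1,…,p_M in this order
HullEdges : ℕ → Graph → Set
HullEdges M G = (∀ i → 1 ≤ i → i < M → Adj G i (suc i)) × Adj G 1 M

-- A bounded face, given by its m vertices p_{s 0} < … < p_{s (m-1)}
-- (clockwise): consecutive vertices (cyclically) are joined by edges and
-- no edge joins two non-consecutive ones (no edge lies inside the polygon).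
-- For a plane graph on convex points containing all hull edges these are
-- exactly the bounded faces.
Face : ℕ → Graph → (m : ℕ) → (ℕ → ℕ) → Set
Face M G m s =
  3 ≤ m × 1 ≤ s 0 × s (m ∸ 1) ≤ M ×
  (∀ i → suc i < m → s i < s (suc i)) ×
  (∀ i → suc i < m → Adj G (s i) (s (suc i))) ×
  Adj G (s 0) (s (m ∸ 1)) ×
  (∀ i j → i < j → j < m → Adj G (s i) (s j) → j ≡ suc i ⊎ (i ≡ 0 × j ≡ m ∸ 1))

Tiling : (t M : ℕ) → Graph → Set
Tiling t M G = PlaneGraph M G × HullEdges M G ×
  (∀ m s → Face M G m s → m ≡ t)

-- N points p_1,…,p_{N+2}.  d_i counts j with i+1 < j ≤ N+2 and p_i p_j
-- an edge: these are exactly the non-hull edges p_i p_j with j > i,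
-- together with the hull edge p_1 p_{N+2} (for i = 1).

outdeg : (N : ℕ) → Graph → ℕ → ℕ
outdeg N G i =
  length (filter (λ j → Adj? G i j) (map (λ x → i + 2 + x) (upTo ((N + 2) ∸ (i + 1)))))

bits : (N : ℕ) → Graph → List Bool
bits N G = concatMap (λ x → replicate (outdeg N G (suc x)) true ++ (false ∷ [])) (upTo N)

-- stack scan; position j (1-based), stack of indices.  (A pop on an empty
-- stack never happens for triangulations; it is just skipped.)
scan : List Bool → ℕ → List ℕ → List (ℕ × ℕ)
scan [] j st = []
scan (true ∷ bs) j st = scan bs (suc j) (j ∷ st)
scan (false ∷ bs) j [] = scan bs (suc j) []
scan (false ∷ bs) j (l ∷ st) = (l , j) ∷ scan bs (suc j) st

-- M(T) on v_1,…,v_{2N}: edge (ℓ , j) means v_ℓ v_j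
matching : (N : ℕ) → Graph → List (ℕ × ℕ)
matching N G = scan (bits N G) 1 []

-- Coloring: v_m is in block i = (m-1)/k + 1 at position r = (m-1)%k + 1;
-- its color is (the index of) c_r if i is odd, c_{k+1-r} if i is even.
-- (k = 0 gets a junk value; it never occurs.)

isEven : ℕ → Bool
isEven zero = true
isEven (suc zero) = false
isEven (suc (suc n)) = isEven n

color : (k : ℕ) → ℕ → ℕ
color zero m = 0
color (suc k') m =
  if isEven ((m ∸ 1) / suc k')
  then suc ((m ∸ 1) % suc k')
  else suc k' ∸ ((m ∸ 1) % suc k')

KValidTri : (k N : ℕ) → Graph → Set
KValidTri k N T = ∀ l j → (l , j) ∈ matching N T → color k l ≡ color k j

KValidTiling : (k t N : ℕ) → Graph → Set
KValidTiling k t N G =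
  Tiling t (N + 2) G ×
  ∃ λ T → Triangulation (N + 2) T × (∀ a b → Adj G a b → Adj T a b) × KValidTri k N T

-- Ear at p_r p_{r+1}: insert k new points between p_r and p_{r+1};
-- relabeling clockwise from p_1, old p_i (i ≤ r) keeps label i, old p_i
-- (i > r) gets label i + k, new points get labels r+1,…,r+k.  New edges:
-- the path p_r, p_{r+1}, …, p_{r+k+1} (the new face p_r,…,p_{r+k+1}; the
-- old edge e becomes p_r p_{r+k+1}).

relabel : (k r : ℕ) → ℕ → ℕ
relabel k r i = if i ≤ᵇ r then i else i + k

ear : (k r : ℕ) → Graph → Graph
ear k r G =
  map (λ e → relabel k r (proj₁ e) , relabel k r (proj₂ e)) G ++
  map (λ x → r + x , suc (r + x)) (upTo (suc k))

module Submission where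

-- Triangulate the new face by the fan from p_r to its first a new points and the fan from the
-- a-th new point p_{r+a} to the remaining ones, and add this to a k-color valid triangulation T
-- containing the tiling. In the 0/1-sequence this inserts the word 1^a 0^a 1^c 0^c (c = k − a)
-- right after the ones of p_r, and leaves everything else unchanged up to a shift of 2k. Choosing
-- a so that the inserted word starts a positions before a block boundary, each of the two nests
-- 1^a 0^a and 1^c 0^c is matched symmetrically about a block boundary, where the colouring is
-- mirrored, so its edges are monochromatic; the old matching edges after the insertion move by 2k,
-- a period of the colouring. The tiling conditions for the extended graph follow by relabelling
-- the old points: the only new face is the ear, since the old edge p_r p_{r+1} closes it off.


open import Defs
open import Data.Nat
open import Data.Nat.Properties
open import Data.Nat.DivMod
open import Data.Nat.Divisibility using (_∣_; divides)
open import Data.Nat.Tactic.RingSolver using (solve-∀)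
open import Data.Bool using (Bool; true; false; if_then_else_; not; T)
open import Data.Unit using (tt)
open import Data.Empty using (⊥-elim)
open import Data.List using (List; []; _∷_; _++_; map; length; replicate; upTo; applyUpTo; filter; concatMap)
open import Data.List.Properties using (++-assoc; ++-identityʳ; ∷-injectiveˡ; ∷-injectiveʳ; ∷ʳ-injectiveˡ; map-upTo)
open import Data.List.Membership.Propositional using (_∈_)
open import Data.List.Membership.Propositional.Properties
  using (∈-++⁻; ∈-++⁺ˡ; ∈-++⁺ʳ; ∈-map⁺; ∈-map⁻; ∈-upTo⁺; ∈-upTo⁻)
open import Data.List.Relation.Unary.Any using (here; there)
open import Data.Product using (_×_; _,_; proj₁; proj₂; Σ)
open import Data.Sum using (_⊎_; inj₁; inj₂; [_,_]′)
open import Function using (_∘_)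
open import Relation.Nullary using (¬_; yes; no; does)
open import Relation.Nullary.Decidable using (dec-true; dec-false; does-⇔)
open import Function.Bundles using (mk⇔)
open import Relation.Unary using (Decidable)
open import Relation.Binary.Definitions using (tri<; tri≈; tri>)
open import Relation.Binary.PropositionalEquality
import Data.List.Relation.Unary.All as All

isEven-suc : ∀ q → isEven (suc q) ≡ not (isEven q)
isEven-suc zero = refl
isEven-suc (suc zero) = refl
isEven-suc (suc (suc q)) = isEven-suc q

isEven-+2 : ∀ q → isEven (q + 2) ≡ isEven q
isEven-+2 q rewrite +-comm q 2 = refl

-- Offset e in block q, both counted from 0.
color-inBlock : ∀ k e q → e < suc k →
  color (suc k) (suc (e + q * suc k)) ≡ (if isEven q then suc e else suc k ∸ e)
color-inBlock k e q e<k =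
  cong₂ (λ d m → if isEven d then suc m else suc k ∸ m) block-index block-offset
  where
  block-index : (e + q * suc k) / suc k ≡ q
  block-index = trans (+-distrib-/-∣ʳ e (divides q refl)) (cong₂ _+_ (m<n⇒m/n≡0 e<k) (m*n/n≡m q (suc k)))
  block-offset : (e + q * suc k) % suc k ≡ e
  block-offset = trans ([m+kn]%n≡m%n e q (suc k)) (m<n⇒m%n≡m e<k)

color-reflect : ∀ k q e → e < suc k →
  color (suc k) (suc ((k ∸ e) + q * suc k)) ≡ color (suc k) (suc (e + suc q * suc k))
color-reflect k q e e<k = begin
  color (suc k) (suc ((k ∸ e) + q * suc k))        ≡⟨ color-inBlock k (k ∸ e) q (s≤s (m∸n≤m k e)) ⟩
  (if isEven q then suc (k ∸ e) else suc k ∸ (k ∸ e)) ≡⟨ flip (isEven q) ⟩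
  (if not (isEven q) then suc e else suc k ∸ e)      ≡⟨ cong (λ b → if b then suc e else suc k ∸ e) (isEven-suc q) ⟨
  (if isEven (suc q) then suc e else suc k ∸ e)      ≡⟨ color-inBlock k e (suc q) e<k ⟨
  color (suc k) (suc (e + suc q * suc k)) ∎
  where
  open ≡-Reasoning
  flip : ∀ b → (if b then suc (k ∸ e) else suc k ∸ (k ∸ e)) ≡ (if not b then suc e else suc k ∸ e)
  flip true = sym (+-∸-assoc 1 (≤-pred e<k))
  flip false = m∸[m∸n]≡n e<k

color-periodic : ∀ k m → color (suc k) (suc m + 2 * suc k) ≡ color (suc k) (suc m)
color-periodic k m = begin
  color (suc k) (suc m + 2 * suc k)               ≡⟨ cong (λ z → color (suc k) (suc z + 2 * suc k)) m≡ ⟩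
  color (suc k) (suc (e + q * suc k) + 2 * suc k) ≡⟨ cong (color (suc k)) (two-blocks-later e q k) ⟩
  color (suc k) (suc (e + (q + 2) * suc k))       ≡⟨ color-inBlock k e (q + 2) e<k ⟩
  (if isEven (q + 2) then suc e else suc k ∸ e)   ≡⟨ cong (λ b → if b then suc e else suc k ∸ e) (isEven-+2 q) ⟩
  (if isEven q then suc e else suc k ∸ e)         ≡⟨ color-inBlock k e q e<k ⟨
  color (suc k) (suc (e + q * suc k))             ≡⟨ cong (λ z → color (suc k) (suc z)) m≡ ⟨
  color (suc k) (suc m) ∎
  where
  open ≡-Reasoning
  e = m % suc k
  q = m / suc k
  m≡ : m ≡ e + q * suc k
  m≡ = m≡m%n+[m/n]*n m (suc k)
  e<k : e < suc k
  e<k = m%n<n m (suc k)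
  two-blocks-later : ∀ e q k → suc (e + q * suc k) + 2 * suc k ≡ suc (e + (q + 2) * suc k)
  two-blocks-later = solve-∀

scanStack : List Bool → ℕ → List ℕ → List ℕ
scanStack [] j st = st
scanStack (true ∷ bs) j st = scanStack bs (suc j) (j ∷ st)
scanStack (false ∷ bs) j [] = scanStack bs (suc j) []
scanStack (false ∷ bs) j (l ∷ st) = scanStack bs (suc j) st

scan-++ : ∀ xs ys j st → scan (xs ++ ys) j st ≡ scan xs j st ++ scan ys (j + length xs) (scanStack xs j st)
scan-++ [] ys j st rewrite +-identityʳ j = refl
scan-++ (true ∷ xs) ys j st rewrite +-suc j (length xs) = scan-++ xs ys (suc j) (j ∷ st)
scan-++ (false ∷ xs) ys j [] rewrite +-suc j (length xs) = scan-++ xs ys (suc j) []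
scan-++ (false ∷ xs) ys j (l ∷ st) rewrite +-suc j (length xs) = cong ((l , j) ∷_) (scan-++ xs ys (suc j) st)

pushed : ℕ → ℕ → List ℕ
pushed zero j = []
pushed (suc a) j = j + a ∷ pushed a j

popped : ℕ → ℕ → ℕ → List (ℕ × ℕ)
popped zero j j′ = []
popped (suc a) j j′ = (j + a , j′) ∷ popped a j (suc j′)

pushed-suc : ∀ a j → pushed a (suc j) ++ j ∷ [] ≡ pushed (suc a) j
pushed-suc zero j = cong (_∷ []) (sym (+-identityʳ j))
pushed-suc (suc a) j = cong₂ _∷_ (sym (+-suc j a)) (pushed-suc a j)

scan-push : ∀ a bs j st → scan (replicate a true ++ bs) j st ≡ scan bs (j + a) (pushed a j ++ st)
scan-push zero bs j st rewrite +-identityʳ j = refl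
scan-push (suc a) bs j st rewrite +-suc j a =
  trans (scan-push a bs (suc j) (j ∷ st))
        (cong (scan bs (suc j + a)) (trans (sym (++-assoc (pushed a (suc j)) (j ∷ []) st)) (cong (_++ st) (pushed-suc a j))))

scan-pop : ∀ a bs j j′ st → scan (replicate a false ++ bs) j′ (pushed a j ++ st) ≡ popped a j j′ ++ scan bs (j′ + a) st
scan-pop zero bs j j′ st rewrite +-identityʳ j′ = refl
scan-pop (suc a) bs j j′ st rewrite +-suc j′ a = cong ((j + a , j′) ∷_) (scan-pop a bs j (suc j′) st)

scan-nest : ∀ a bs j st → scan (replicate a true ++ replicate a false ++ bs) j st ≡ popped a j (j + a) ++ scan bs (j + a + a) st
scan-nest a bs j st = trans (scan-push a (replicate a false ++ bs) j st) (scan-pop a bs j (j + a) st)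

Monochromatic : ℕ → List (ℕ × ℕ) → Set
Monochromatic k L = ∀ l m → (l , m) ∈ L → color k l ≡ color k m

Monochromatic-++⁺ : ∀ k xs ys → Monochromatic k xs → Monochromatic k ys → Monochromatic k (xs ++ ys)
Monochromatic-++⁺ k xs ys mx my l m p with ∈-++⁻ xs p
... | inj₁ q = mx l m q
... | inj₂ q = my l m q

Monochromatic-++⁻ˡ : ∀ k xs ys → Monochromatic k (xs ++ ys) → Monochromatic k xs
Monochromatic-++⁻ˡ k xs ys mono l m p = mono l m (∈-++⁺ˡ p)

Monochromatic-++⁻ʳ : ∀ k xs ys → Monochromatic k (xs ++ ys) → Monochromatic k ys
Monochromatic-++⁻ʳ k xs ys mono l m p = mono l m (∈-++⁺ʳ xs p)

-- The popped pairs are mirror images across the start of block q + 1, where the colouring is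
-- reflected.
popped-monochromatic : ∀ k q A e j j′ → j + A + e ≡ suc (suc q * suc k) → suc (suc q * suc k) + e ≡ j′ →
  A + e ≤ suc k → Monochromatic (suc k) (popped A j j′)
popped-monochromatic k q zero e j j′ _ _ _ l m ()
popped-monochromatic k q (suc A) e j j′ left right le l m (here refl) = begin
  color (suc k) (j + A)                     ≡⟨ cong (color (suc k)) mirror ⟩
  color (suc k) (suc ((k ∸ e) + q * suc k)) ≡⟨ color-reflect k q e (s≤s e≤k) ⟩
  color (suc k) (suc (e + suc q * suc k))   ≡⟨ cong (λ z → color (suc k) (suc z)) (+-comm e (suc q * suc k)) ⟩
  color (suc k) (suc (suc q * suc k) + e)   ≡⟨ cong (color (suc k)) right ⟩
  color (suc k) j′ ∎
  where
  open ≡-Reasoning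
  e≤k : e ≤ k
  e≤k = ≤-pred (≤-trans (s≤s (m≤n+m e A)) le)
  shuffle : ∀ u e Q → suc (u + e + Q) ≡ suc (u + Q) + e
  shuffle = solve-∀
  mirror : j + A ≡ suc ((k ∸ e) + q * suc k)
  mirror = +-cancelʳ-≡ e _ _ (begin
    j + A + e                  ≡⟨ suc-injective (trans (cong (_+ e) (sym (+-suc j A))) left) ⟩
    suc (k + q * suc k)        ≡⟨ cong (λ z → suc (z + q * suc k)) (m∸n+n≡m e≤k) ⟨
    suc (k ∸ e + e + q * suc k) ≡⟨ shuffle (k ∸ e) e (q * suc k) ⟩
    suc (k ∸ e + q * suc k) + e ∎)
popped-monochromatic k q (suc A) e j j′ left right le l m (there p) =
  popped-monochromatic k q A (suc e) j (suc j′)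
    (trans (+-suc (j + A) e) (trans (cong (_+ e) (sym (+-suc j A))) left))
    (trans (+-suc _ e) (cong suc right))
    (≤-trans (≤-reflexive (+-suc A e)) le) l m p

colourPair : ℕ → ℕ × ℕ → ℕ × ℕ
colourPair k (l , m) = color k l , color k m

scan-shift : ∀ k d → (∀ i → color k (suc i + d) ≡ color k (suc i)) →
  ∀ bs j st st′ → map (color k) st ≡ map (color k) st′ →
  map (colourPair k) (scan bs (suc j + d) st) ≡ map (colourPair k) (scan bs (suc j) st′)
scan-shift k d per [] j st st′ e = refl
scan-shift k d per (true ∷ bs) j st st′ e =
  scan-shift k d per bs (suc j) (suc j + d ∷ st) (suc j ∷ st′) (cong₂ _∷_ (per j) e)
scan-shift k d per (false ∷ bs) j [] [] e = scan-shift k d per bs (suc j) [] [] refl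
scan-shift k d per (false ∷ bs) j (l ∷ st) (l′ ∷ st′) e =
  cong₂ _∷_ (cong₂ _,_ (∷-injectiveˡ e) (per j)) (scan-shift k d per bs (suc j) st st′ (∷-injectiveʳ e))

Monochromatic-colourPair : ∀ k xs ys → map (colourPair k) xs ≡ map (colourPair k) ys →
  Monochromatic k ys → Monochromatic k xs
Monochromatic-colourPair k xs ys eq my l m p
  with ∈-map⁻ (colourPair k) (subst ((color k l , color k m) ∈_) eq (∈-map⁺ (colourPair k) p))
... | (l′ , m′) , q , eq′ = trans (cong proj₁ eq′) (trans (my l′ m′ q) (sym (cong proj₂ eq′)))

nests : ℕ → ℕ → List Bool → List Bool
nests a c bs = replicate a true ++ replicate a false ++ replicate c true ++ replicate c false ++ bs

nests-++ : ∀ a c xs ys → nests a c xs ++ ys ≡ nests a c (xs ++ ys)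
nests-++ a c xs ys =
  trans (++-assoc (replicate a true) _ ys) (cong (replicate a true ++_)
  (trans (++-assoc (replicate a false) _ ys) (cong (replicate a false ++_)
  (trans (++-assoc (replicate c true) _ ys) (cong (replicate c true ++_)
  (++-assoc (replicate c false) xs ys))))))

-- The first nest is mirrored across the block boundary after P, the second across the next
-- one; everything after them moves by 2k, a period of the colouring.
scan-nests-monochromatic : ∀ k q a c (P R : List Bool) → 1 ≤ k →
  length P + a ≡ suc q * k → a + c ≡ k →
  Monochromatic k (scan (P ++ R) 1 []) → Monochromatic k (scan (P ++ nests a c R) 1 [])
scan-nests-monochromatic (suc k) q a c P R _ pa ac mono =
  subst (Monochromatic (suc k)) (sym decompose)
    (Monochromatic-++⁺ (suc k) _ _ monoP
      (Monochromatic-++⁺ (suc k) _ _ monoFirst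
        (Monochromatic-++⁺ (suc k) _ _ monoSecond monoR)))
  where
  p = length P
  S = scanStack P 1 []
  j₂ = suc p + a + a
  decompose : scan (P ++ nests a c R) 1 [] ≡
    scan P 1 [] ++ popped a (suc p) (suc p + a) ++ popped c j₂ (j₂ + c) ++ scan R (j₂ + c + c) S
  decompose = begin
    scan (P ++ nests a c R) 1 []                       ≡⟨ scan-++ P (nests a c R) 1 [] ⟩
    scan P 1 [] ++ scan (nests a c R) (suc p) S         ≡⟨ cong (scan P 1 [] ++_) (scan-nest a _ (suc p) S) ⟩
    scan P 1 [] ++ popped a (suc p) (suc p + a) ++ scan (replicate c true ++ replicate c false ++ R) j₂ S
      ≡⟨ cong (λ z → scan P 1 [] ++ popped a (suc p) (suc p + a) ++ z) (scan-nest c R j₂ S) ⟩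
    scan P 1 [] ++ popped a (suc p) (suc p + a) ++ popped c j₂ (j₂ + c) ++ scan R (j₂ + c + c) S ∎
    where open ≡-Reasoning
  split : Monochromatic (suc k) (scan P 1 [] ++ scan R (suc p) S)
  split = subst (Monochromatic (suc k)) (scan-++ P R 1 []) mono
  monoP : Monochromatic (suc k) (scan P 1 [])
  monoP = Monochromatic-++⁻ˡ (suc k) _ _ split
  monoFirst : Monochromatic (suc k) (popped a (suc p) (suc p + a))
  monoFirst = popped-monochromatic k q a 0 (suc p) (suc p + a)
    (trans (+-identityʳ _) (cong suc pa)) (trans (+-identityʳ _) (cong suc (sym pa)))
    (≤-trans (≤-reflexive (+-identityʳ a)) (subst (a ≤_) ac (m≤m+n a c)))
  second-boundary : j₂ + c ≡ suc (suc (suc q) * suc k)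
  second-boundary = begin
    suc p + a + a + c   ≡⟨ +-assoc (suc p + a) a c ⟩
    suc p + a + (a + c) ≡⟨ cong₂ (λ u v → suc u + v) pa ac ⟩
    suc (suc q * suc k) + suc k ≡⟨ cong suc (+-comm (suc q * suc k) (suc k)) ⟩
    suc (suc (suc q) * suc k) ∎
    where open ≡-Reasoning
  monoSecond : Monochromatic (suc k) (popped c j₂ (j₂ + c))
  monoSecond = popped-monochromatic k (suc q) c 0 j₂ (j₂ + c)
    (trans (+-identityʳ _) second-boundary) (trans (+-identityʳ _) (sym second-boundary))
    (≤-trans (≤-reflexive (+-identityʳ c)) (subst (c ≤_) ac (m≤n+m c a)))
  two-blocks-later : j₂ + c + c ≡ suc p + 2 * suc k
  two-blocks-later = trans (shuffle p a c) (cong (λ z → suc (p + 2 * z)) ac)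
    where shuffle : ∀ p a c → suc p + a + a + c + c ≡ suc (p + 2 * (a + c))
          shuffle = solve-∀
  monoR : Monochromatic (suc k) (scan R (j₂ + c + c) S)
  monoR = subst (λ j → Monochromatic (suc k) (scan R j S)) (sym two-blocks-later)
    (Monochromatic-colourPair (suc k) _ _
      (scan-shift (suc k) (2 * suc k) (color-periodic k) R p S S refl)
      (Monochromatic-++⁻ʳ (suc k) _ _ split))

module Relabelling (k r : ℕ) where

  relabel-≤ : ∀ {x} → x ≤ r → relabel k r x ≡ x
  relabel-≤ {x} p with x ≤ᵇ r | ≤⇒≤ᵇ p
  ... | true | _ = refl

  relabel-> : ∀ {x} → r < x → relabel k r x ≡ x + k
  relabel-> {x} p with x ≤ᵇ r in eq
  ... | false = refl
  ... | true = ⊥-elim (<⇒≱ p (≤ᵇ⇒≤ x r (subst T (sym eq) tt)))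

  Old : ℕ → Set
  Old x = x ≤ r ⊎ r + k < x

  Inserted : ℕ → Set
  Inserted x = r < x × x ≤ r + k

  Old⇒¬Inserted : ∀ {x} → Old x → ¬ Inserted x
  Old⇒¬Inserted (inj₁ p) (q , _) = <⇒≱ q p
  Old⇒¬Inserted (inj₂ p) (_ , q) = <⇒≱ p q

  old-or-inserted : ∀ x → Old x ⊎ Inserted x
  old-or-inserted x with x ≤? r | x ≤? r + k
  ... | yes p | _ = inj₁ (inj₁ p)
  ... | no p | yes q = inj₂ (≰⇒> p , q)
  ... | no _ | no q = inj₁ (inj₂ (≰⇒> q))

  relabel-Old : ∀ x → Old (relabel k r x)
  relabel-Old x with x ≤? r
  ... | yes p = inj₁ (subst (_≤ r) (sym (relabel-≤ p)) p)
  ... | no p = inj₂ (subst (r + k <_) (sym (relabel-> (≰⇒> p))) (+-monoˡ-< k (≰⇒> p)))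

  relabel-mono-< : ∀ {x y} → x < y → relabel k r x < relabel k r y
  relabel-mono-< {x} {y} x<y with x ≤? r | y ≤? r
  ... | yes p | yes q rewrite relabel-≤ p | relabel-≤ q = x<y
  ... | yes p | no q rewrite relabel-≤ p | relabel-> (≰⇒> q) = <-≤-trans x<y (m≤m+n y k)
  ... | no p | yes q = ⊥-elim (p (≤-trans (<⇒≤ x<y) q))
  ... | no p | no q rewrite relabel-> (≰⇒> p) | relabel-> (≰⇒> q) = +-monoˡ-< k x<y

  relabel-mono-≤ : ∀ {x y} → x ≤ y → relabel k r x ≤ relabel k r y
  relabel-mono-≤ p with m≤n⇒m<n∨m≡n p
  ... | inj₁ q = <⇒≤ (relabel-mono-< q)
  ... | inj₂ refl = ≤-refl

  relabel-cancel-< : ∀ {x y} → relabel k r x < relabel k r y → x < y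
  relabel-cancel-< {x} {y} p with <-cmp x y
  ... | tri< x<y _ _ = x<y
  ... | tri≈ _ refl _ = ⊥-elim (<-irrefl refl p)
  ... | tri> _ _ y<x = ⊥-elim (<-asym p (relabel-mono-< y<x))

  relabel-cancel-≤ : ∀ {x y} → relabel k r x ≤ relabel k r y → x ≤ y
  relabel-cancel-≤ p = ≮⇒≥ (λ y<x → <⇒≱ (relabel-mono-< y<x) p)

  relabel-injective : ∀ {x y} → relabel k r x ≡ relabel k r y → x ≡ y
  relabel-injective p = ≤-antisym (relabel-cancel-≤ (≤-reflexive p)) (relabel-cancel-≤ (≤-reflexive (sym p)))

  1≤relabel⇒1≤ : ∀ {x} → 1 ≤ relabel k r x → 1 ≤ x
  1≤relabel⇒1≤ {zero} p = ⊥-elim (<⇒≱ p (≤-reflexive (relabel-≤ z≤n)))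
  1≤relabel⇒1≤ {suc x} p = s≤s z≤n

  relabel-top : ∀ n → r ≤ n + 1 → relabel k r (n + 2) ≡ n + k + 2
  relabel-top n r≤n+1 = trans (relabel-> (≤-trans (s≤s r≤n+1) (≤-reflexive (sym (+-suc n 1))))) (shuffle n k)
    where shuffle : ∀ n k → n + 2 + k ≡ n + k + 2
          shuffle = solve-∀

  unlabel : ℕ → ℕ
  unlabel x = if x ≤ᵇ r then x else x ∸ k

  unlabel-≤ : ∀ {x} → x ≤ r → unlabel x ≡ x
  unlabel-≤ {x} p with x ≤ᵇ r | ≤⇒≤ᵇ p
  ... | true | _ = refl

  unlabel-> : ∀ {x} → r < x → unlabel x ≡ x ∸ k
  unlabel-> {x} p with x ≤ᵇ r in eq
  ... | false = refl
  ... | true = ⊥-elim (<⇒≱ p (≤ᵇ⇒≤ x r (subst T (sym eq) tt)))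

  unlabel-relabel : ∀ x → unlabel (relabel k r x) ≡ x
  unlabel-relabel x with x ≤? r
  ... | yes p rewrite relabel-≤ p = unlabel-≤ p
  ... | no p rewrite relabel-> (≰⇒> p) = trans (unlabel-> (<-≤-trans (≰⇒> p) (m≤m+n x k))) (m+n∸n≡m x k)

  relabel-unlabel : ∀ {x} → Old x → relabel k r (unlabel x) ≡ x
  relabel-unlabel (inj₁ p) rewrite unlabel-≤ p = relabel-≤ p
  relabel-unlabel {x} (inj₂ p) rewrite unlabel-> (≤-trans (s≤s (m≤m+n r k)) p) =
    trans (relabel-> r<x∸k) (m∸n+n≡m k≤x)
    where
    k≤x : k ≤ x
    k≤x = ≤-trans (m≤n+m k r) (<⇒≤ p)
    r<x∸k : r < x ∸ k
    r<x∸k = +-cancelʳ-< k r (x ∸ k) (subst (r + k <_) (sym (m∸n+n≡m k≤x)) p)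

  Inserted-r+ : ∀ {d} → 1 ≤ d → d ≤ k → Inserted (r + d)
  Inserted-r+ 1≤d d≤k = m<m+n r 1≤d , +-monoʳ-≤ r d≤k

  relabel-Cross : ∀ {a b c d} → Cross a b c d → Cross (relabel k r a) (relabel k r b) (relabel k r c) (relabel k r d)
  relabel-Cross (p , q , s) = relabel-mono-< p , relabel-mono-< q , relabel-mono-< s

  relabel-Cross⁻ : ∀ {a b c d} → Cross (relabel k r a) (relabel k r b) (relabel k r c) (relabel k r d) → Cross a b c d
  relabel-Cross⁻ (p , q , s) = relabel-cancel-< p , relabel-cancel-< q , relabel-cancel-< s

Adj-sym : ∀ {G u v} → Adj G u v → Adj G v u
Adj-sym (inj₁ p) = inj₂ p
Adj-sym (inj₂ p) = inj₁ p

module EarGraph (k r : ℕ) (1≤k : 1 ≤ k) where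
  open Relabelling k r

  relabelEdge : ℕ × ℕ → ℕ × ℕ
  relabelEdge e = relabel k r (proj₁ e) , relabel k r (proj₂ e)

  pathEdge : ℕ → ℕ × ℕ
  pathEdge x = r + x , suc (r + x)

  ImageEdge : Graph → ℕ → ℕ → Set
  ImageEdge X x y = Σ ℕ λ c → Σ ℕ λ d → Adj X c d × x ≡ relabel k r c × y ≡ relabel k r d

  PathEdge : ℕ → ℕ → Set
  PathEdge x y = Σ ℕ λ m → m ≤ k × x ≡ r + m × y ≡ suc (r + m)

  ∈-ear⁻ : ∀ X {x y} → (x , y) ∈ ear k r X →
    (Σ ℕ λ c → Σ ℕ λ d → (c , d) ∈ X × x ≡ relabel k r c × y ≡ relabel k r d) ⊎ PathEdge x y
  ∈-ear⁻ X p with ∈-++⁻ (map relabelEdge X) p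
  ... | inj₁ q with ∈-map⁻ relabelEdge q
  ... | (c , d) , cd , refl = inj₁ (c , d , cd , refl , refl)
  ∈-ear⁻ X p | inj₂ q with ∈-map⁻ pathEdge q
  ... | m , m∈ , refl = inj₂ (m , ≤-pred (∈-upTo⁻ m∈) , refl , refl)

  Adj-ear⁻ : ∀ X {x y} → Adj (ear k r X) x y → ImageEdge X x y ⊎ PathEdge x y ⊎ PathEdge y x
  Adj-ear⁻ X (inj₁ p) with ∈-ear⁻ X p
  ... | inj₁ (c , d , cd , refl , refl) = inj₁ (c , d , inj₁ cd , refl , refl)
  ... | inj₂ q = inj₂ (inj₁ q)
  Adj-ear⁻ X (inj₂ p) with ∈-ear⁻ X p
  ... | inj₁ (c , d , cd , refl , refl) = inj₁ (d , c , inj₂ cd , refl , refl)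
  ... | inj₂ q = inj₂ (inj₂ q)

  Adj-ear-relabel : ∀ X {c d} → Adj X c d → Adj (ear k r X) (relabel k r c) (relabel k r d)
  Adj-ear-relabel X (inj₁ p) = inj₁ (∈-++⁺ˡ (∈-map⁺ relabelEdge p))
  Adj-ear-relabel X (inj₂ p) = inj₂ (∈-++⁺ˡ (∈-map⁺ relabelEdge p))

  Adj-ear-path : ∀ X {m} → m ≤ k → Adj (ear k r X) (r + m) (suc (r + m))
  Adj-ear-path X p = inj₁ (∈-++⁺ʳ (map relabelEdge X) (∈-map⁺ pathEdge (∈-upTo⁺ (s≤s p))))

  Adj-ear-r : ∀ X → Adj X r (suc r) → Adj (ear k r X) r (suc (r + k))
  Adj-ear-r X h = subst₂ (Adj (ear k r X)) (relabel-≤ ≤-refl) (relabel-> ≤-refl) (Adj-ear-relabel X h)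

  ear-mono : ∀ X Y → (∀ c d → Adj X c d → Adj Y c d) → ∀ x y → Adj (ear k r X) x y → Adj (ear k r Y) x y
  ear-mono X Y X⊆Y x y h with Adj-ear⁻ X h
  ... | inj₁ (c , d , cd , refl , refl) = Adj-ear-relabel Y (X⊆Y c d cd)
  ... | inj₂ (inj₁ (m , m≤k , refl , refl)) = Adj-ear-path Y m≤k
  ... | inj₂ (inj₂ (m , m≤k , refl , refl)) = Adj-sym (Adj-ear-path Y m≤k)

  PathEdge-Inserted : ∀ {x y} → PathEdge x y → Inserted x ⊎ Inserted y
  PathEdge-Inserted (zero , _ , refl , refl) =
    inj₂ (s≤s (≤-reflexive (sym (+-identityʳ r))) , subst (_≤ r + k) (+-suc r 0) (+-monoʳ-≤ r 1≤k))
  PathEdge-Inserted (suc m , m<k , refl , refl) = inj₁ (m<m+n r (s≤s z≤n) , +-monoʳ-≤ r m<k)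

  Adj-ear-Inserted : ∀ X {x y} → Inserted x → Adj (ear k r X) x y → y ≡ suc x ⊎ suc y ≡ x
  Adj-ear-Inserted X ins h with Adj-ear⁻ X h
  ... | inj₁ (c , _ , _ , refl , _) = ⊥-elim (Old⇒¬Inserted (relabel-Old c) ins)
  ... | inj₂ (inj₁ (_ , _ , refl , refl)) = inj₁ refl
  ... | inj₂ (inj₂ (_ , _ , refl , refl)) = inj₂ refl

  Adj-ear-Old⁻ : ∀ X {x y} → Old x → Old y → Adj (ear k r X) x y → Adj X (unlabel x) (unlabel y)
  Adj-ear-Old⁻ X ox oy h with Adj-ear⁻ X h
  ... | inj₁ (c , d , cd , refl , refl) = subst₂ (Adj X) (sym (unlabel-relabel c)) (sym (unlabel-relabel d)) cd
  ... | inj₂ (inj₁ path) = [ ⊥-elim ∘ Old⇒¬Inserted ox , ⊥-elim ∘ Old⇒¬Inserted oy ]′ (PathEdge-Inserted path)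
  ... | inj₂ (inj₂ path) = [ ⊥-elim ∘ Old⇒¬Inserted oy , ⊥-elim ∘ Old⇒¬Inserted ox ]′ (PathEdge-Inserted path)

all-below-or-witness : ∀ {P Q : ℕ → Set} m → (∀ i → P i ⊎ Q i) →
  (Σ ℕ λ i → i < m × Q i) ⊎ (∀ i → i < m → P i)
all-below-or-witness zero _ = inj₂ (λ _ ())
all-below-or-witness {P} (suc m) P⊎Q with all-below-or-witness m P⊎Q | P⊎Q m
... | inj₁ (i , i<m , q) | _ = inj₁ (i , m<n⇒m<1+n i<m , q)
... | inj₂ _ | inj₂ q = inj₁ (m , ≤-refl , q)
... | inj₂ below | inj₁ p = inj₂ upTo-m
  where
  upTo-m : ∀ i → i < suc m → P i
  upTo-m i i<1+m with m≤n⇒m<n∨m≡n (≤-pred i<1+m)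
  ... | inj₁ i<m = below i i<m
  ... | inj₂ refl = p

ValidEdge : ℕ → ℕ × ℕ → Set
ValidEdge M e = 1 ≤ proj₁ e × proj₁ e ≤ M × 1 ≤ proj₂ e × proj₂ e ≤ M × proj₁ e ≢ proj₂ e

ValidEdge-< : ∀ {M x y} → 1 ≤ x → x < y → y ≤ M → ValidEdge M (x , y)
ValidEdge-< 1≤x x<y y≤M = 1≤x , ≤-trans (<⇒≤ x<y) y≤M , ≤-trans 1≤x (<⇒≤ x<y) , y≤M , <⇒≢ x<y

module EarTiling (k r n : ℕ) (1≤k : 1 ≤ k) (1≤r : 1 ≤ r) (r≤n+1 : r ≤ n + 1) (G : Graph) where
  open Relabelling k r
  open EarGraph k r 1≤k

  E : Graph
  E = ear k r G

  r<n+2 : r < n + 2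
  r<n+2 = ≤-trans (s≤s r≤n+1) (≤-reflexive (sym (+-suc n 1)))

  ValidEdge-relabel : ∀ {c d} → ValidEdge (n + 2) (c , d) → ValidEdge (n + k + 2) (relabel k r c , relabel k r d)
  ValidEdge-relabel {c} {d} (1≤c , c≤ , 1≤d , d≤ , c≢d) =
    positive 1≤c , subst (relabel k r c ≤_) (relabel-top n r≤n+1) (relabel-mono-≤ c≤) ,
    positive 1≤d , subst (relabel k r d ≤_) (relabel-top n r≤n+1) (relabel-mono-≤ d≤) ,
    c≢d ∘ relabel-injective
    where
    positive : ∀ {x} → 1 ≤ x → 1 ≤ relabel k r x
    positive {x} 1≤x = subst (_≤ relabel k r x) (relabel-≤ 1≤r) (relabel-mono-≤ 1≤x)

  r+k<n+k+2 : suc (r + k) ≤ n + k + 2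
  r+k<n+k+2 = subst₂ _≤_ (relabel-> ≤-refl) (relabel-top n r≤n+1) (relabel-mono-≤ r<n+2)

  valid-ear : ValidEdges (n + 2) G → ValidEdges (n + k + 2) E
  valid-ear validG = All.tabulate valid
    where
    valid : ∀ {e} → e ∈ E → ValidEdge (n + k + 2) e
    valid {x , y} p with ∈-ear⁻ G p
    ... | inj₁ (c , d , cd , refl , refl) = ValidEdge-relabel (All.lookup validG cd)
    ... | inj₂ (m , m≤k , refl , refl) =
      ValidEdge-< (≤-trans 1≤r (m≤m+n r m)) (n<1+n _) (≤-trans (s≤s (+-monoʳ-≤ r m≤k)) r+k<n+k+2)

  hull-ear : HullEdges (n + 2) G → HullEdges (n + k + 2) E
  hull-ear (sides , closing) = side , subst₂ (Adj E) (relabel-≤ 1≤r) (relabel-top n r≤n+1) (Adj-ear-relabel G closing)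
    where
    side : ∀ i → 1 ≤ i → i < n + k + 2 → Adj E i (suc i)
    side i 1≤i i<top with i <? r | i ≤? r + k
    ... | yes i<r | _ = subst₂ (Adj E) (relabel-≤ (<⇒≤ i<r)) (relabel-≤ i<r)
      (Adj-ear-relabel G (sides i 1≤i (<-trans i<r r<n+2)))
    ... | no i≮r | yes i≤r+k = subst₂ (Adj E) i≡ (cong suc i≡)
      (Adj-ear-path G (subst (i ∸ r ≤_) (m+n∸m≡n r k) (∸-monoˡ-≤ r i≤r+k)))
      where
      i≡ : r + (i ∸ r) ≡ i
      i≡ = m+[n∸m]≡n (≮⇒≥ i≮r)
    ... | no _ | no i≰r+k = subst₂ (Adj E) relabel-i₀ (trans (relabel-> (m<n⇒m<1+n r<i₀)) (cong suc (m∸n+n≡m k≤i)))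
      (Adj-ear-relabel G (sides i₀ (≤-trans 1≤r (<⇒≤ r<i₀))
        (relabel-cancel-< (subst₂ _<_ (sym relabel-i₀) (sym (relabel-top n r≤n+1)) i<top))))
      where
      r+k<i : r + k < i
      r+k<i = ≰⇒> i≰r+k
      i₀ = i ∸ k
      k≤i : k ≤ i
      k≤i = ≤-trans (m≤n+m k r) (<⇒≤ r+k<i)
      r<i₀ : r < i₀
      r<i₀ = +-cancelʳ-< k r i₀ (subst (r + k <_) (sym (m∸n+n≡m k≤i)) r+k<i)
      relabel-i₀ : relabel k r i₀ ≡ i
      relabel-i₀ = trans (relabel-> r<i₀) (m∸n+n≡m k≤i)

  module EarFace {m : ℕ} {s : ℕ → ℕ} (F : Face (n + k + 2) E m s) where

    3≤m : 3 ≤ m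
    3≤m = proj₁ F

    1≤first : 1 ≤ s 0
    1≤first = proj₁ (proj₂ F)

    last≤ : s (m ∸ 1) ≤ n + k + 2
    last≤ = proj₁ (proj₂ (proj₂ F))

    step-< : ∀ i → suc i < m → s i < s (suc i)
    step-< = proj₁ (proj₂ (proj₂ (proj₂ F)))

    side : ∀ i → suc i < m → Adj E (s i) (s (suc i))
    side = proj₁ (proj₂ (proj₂ (proj₂ (proj₂ F))))

    closing : Adj E (s 0) (s (m ∸ 1))
    closing = proj₁ (proj₂ (proj₂ (proj₂ (proj₂ (proj₂ F)))))

    chordless : ∀ i j → i < j → j < m → Adj E (s i) (s j) → j ≡ suc i ⊎ (i ≡ 0 × j ≡ m ∸ 1)
    chordless = proj₂ (proj₂ (proj₂ (proj₂ (proj₂ (proj₂ F)))))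

    increasing : ∀ i j → i < j → j < m → s i < s j
    increasing i (suc j) i<1+j 1+j<m with m≤n⇒m<n∨m≡n (≤-pred i<1+j)
    ... | inj₁ i<j = <-trans (increasing i j i<j (<-trans (n<1+n j) 1+j<m)) (step-< j 1+j<m)
    ... | inj₂ refl = step-< i 1+j<m

    m≡suc-last : suc (m ∸ 1) ≡ m
    m≡suc-last = m+[n∸m]≡n (≤-trans (s≤s z≤n) 3≤m)

    last<m : m ∸ 1 < m
    last<m = subst (m ∸ 1 <_) m≡suc-last (n<1+n (m ∸ 1))

    1<last : 1 < m ∸ 1
    1<last = ∸-monoˡ-≤ 1 3≤m

    up-neighbour : ∀ {x y} → Inserted x → Adj E x y → x < y → y ≡ suc x
    up-neighbour ins h x<y with Adj-ear-Inserted G ins h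
    ... | inj₁ y≡ = y≡
    ... | inj₂ refl = ⊥-elim (<-asym x<y (n<1+n _))

    down-neighbour : ∀ {x y} → Inserted y → Adj E x y → x < y → suc x ≡ y
    down-neighbour ins h x<y with Adj-ear-Inserted G ins (Adj-sym h)
    ... | inj₁ refl = ⊥-elim (<-asym x<y (n<1+n _))
    ... | inj₂ x≡ = x≡

    -- Both face neighbours of s 0 lie above it, but an inserted point has only one neighbour above it.
    inserted-index-positive : ∀ {j} → Inserted (s j) → 0 < j
    inserted-index-positive {zero} ins = ⊥-elim (<-irrefl (trans second≡ (sym last≡)) (increasing 1 (m ∸ 1) 1<last last<m))
      where
      second≡ : s 1 ≡ suc (s 0)
      second≡ = up-neighbour ins (side 0 (≤-trans (s≤s (s≤s z≤n)) 3≤m)) (step-< 0 (≤-trans (s≤s (s≤s z≤n)) 3≤m))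
      last≡ : s (m ∸ 1) ≡ suc (s 0)
      last≡ = up-neighbour ins closing (increasing 0 (m ∸ 1) (<-trans (s≤s z≤n) 1<last) last<m)
    inserted-index-positive {suc j} _ = s≤s z≤n

    predecessor : ∀ j → suc j < m → Inserted (s (suc j)) → suc (s j) ≡ s (suc j)
    predecessor j 1+j<m ins = down-neighbour ins (side j 1+j<m) (step-< j 1+j<m)

    successor : ∀ j → j < m → Inserted (s j) → suc j < m × s (suc j) ≡ suc (s j)
    successor j j<m ins with suc j <? m
    ... | yes 1+j<m = 1+j<m , up-neighbour ins (side j 1+j<m) (step-< j 1+j<m)
    ... | no 1+j≮m = ⊥-elim (last-not-inserted j (sym last≡j) ins)
      where
      last≡j : m ∸ 1 ≡ j
      last≡j = cong (_∸ 1) (sym (≤-antisym j<m (≮⇒≥ 1+j≮m)))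
      last-not-inserted : ∀ j → j ≡ m ∸ 1 → ¬ Inserted (s j)
      last-not-inserted zero j≡ _ = <⇒≱ (<-trans (s≤s z≤n) 1<last) (≤-reflexive (sym j≡))
      last-not-inserted (suc j) j≡ ins =
        <-irrefl (suc-injective (trans (down-neighbour ins closing′ (increasing 0 (suc j) (s≤s z≤n) 1+j<m))
                                       (sym (predecessor j 1+j<m ins))))
                 (increasing 0 j (≤-pred (subst (1 <_) (sym j≡) 1<last)) (<-trans (n<1+n j) 1+j<m))
        where
        1+j<m : suc j < m
        1+j<m = subst (_< m) (sym j≡) last<m
        closing′ : Adj E (s 0) (s (suc j))
        closing′ = subst (λ z → Adj E (s 0) (s z)) (sym j≡) closing

    walk-down : ∀ d j → j < m → s j ≡ r + d → d ≤ k → Σ ℕ λ j₀ → j₀ + d ≡ j × s j₀ ≡ r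
    walk-down zero j _ sj≡ _ = j , +-identityʳ j , trans sj≡ (+-identityʳ r)
    walk-down (suc d) zero _ s₀≡ d<k =
      ⊥-elim (<-irrefl refl (inserted-index-positive (subst Inserted (sym s₀≡) (Inserted-r+ (s≤s z≤n) d<k))))
    walk-down (suc d) (suc j) j<m sj≡ d<k with
      walk-down d j (<-trans (n<1+n j) j<m)
        (suc-injective (trans (predecessor j j<m (subst Inserted (sym sj≡) (Inserted-r+ (s≤s z≤n) d<k)))
                              (trans sj≡ (+-suc r d))))
        (<⇒≤ d<k)
    ... | j₀ , j₀+d≡j , sj₀≡r = j₀ , trans (+-suc j₀ d) (cong suc j₀+d≡j) , sj₀≡r

    walk-up : ∀ e j → j < m → s j + e ≡ suc (r + k) → e ≤ k → j + e < m × s (j + e) ≡ suc (r + k)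
    walk-up zero j j<m sj≡ _ =
      subst (_< m) (sym (+-identityʳ j)) j<m , trans (cong s (+-identityʳ j)) (trans (sym (+-identityʳ (s j))) sj≡)
    walk-up (suc e) j j<m sj+e≡ e<k with successor j j<m (r<sj , sj≤r+k)
      where
      sj+e≡r+k : s j + e ≡ r + k
      sj+e≡r+k = suc-injective (trans (sym (+-suc (s j) e)) sj+e≡)
      sj≤r+k : s j ≤ r + k
      sj≤r+k = subst (s j ≤_) sj+e≡r+k (m≤m+n (s j) e)
      r<sj : r < s j
      r<sj = +-cancelʳ-< e r (s j) (subst (r + e <_) (sym sj+e≡r+k) (+-monoʳ-< r e<k))
    ... | 1+j<m , sj≡ = subst (λ z → z < m × s z ≡ suc (r + k)) (sym (+-suc j e))
      (walk-up e (suc j) 1+j<m (trans (cong (_+ e) sj≡) (trans (sym (+-suc (s j) e)) sj+e≡)) (<⇒≤ e<k))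

    -- Walking along the face from an inserted vertex reaches r below it and r + k + 1 above it;
    -- since p_r p_{r+k+1} is an edge, the face is exactly the new one.
    Inserted⇒k+2 : ∀ i → i < m → Inserted (s i) → Adj E r (suc (r + k)) → m ≡ k + 2
    Inserted⇒k+2 i i<m (r<si , si≤r+k) chord = closed-by-chord (walk-down d i i<m si≡r+d d≤k) (walk-up e i i<m si+e≡ e≤k)
      where
      d = s i ∸ r
      e = suc (r + k) ∸ s i
      si≡r+d : s i ≡ r + d
      si≡r+d = sym (m+[n∸m]≡n (<⇒≤ r<si))
      si+e≡ : s i + e ≡ suc (r + k)
      si+e≡ = m+[n∸m]≡n (m≤n⇒m≤1+n si≤r+k)
      d+e≡ : d + e ≡ suc k
      d+e≡ = +-cancelˡ-≡ r (d + e) (suc k)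
        (trans (sym (+-assoc r d e)) (trans (cong (_+ e) (sym si≡r+d)) (trans si+e≡ (sym (+-suc r k)))))
      d≤k : d ≤ k
      d≤k = +-cancelˡ-≤ r d k (subst (_≤ r + k) si≡r+d si≤r+k)
      e≤k : e ≤ k
      e≤k = ≤-pred (subst (suc e ≤_) d+e≡ (+-monoˡ-≤ e (m<n⇒0<n∸m r<si)))
      closed-by-chord : (Σ ℕ λ j₀ → j₀ + d ≡ i × s j₀ ≡ r) → i + e < m × s (i + e) ≡ suc (r + k) → m ≡ k + 2
      closed-by-chord (j₀ , j₀+d≡i , sj₀≡r) (j₁<m , sj₁≡) =
        conclude (chordless j₀ (i + e) j₀<j₁ j₁<m (subst₂ (Adj E) (sym sj₀≡r) (sym sj₁≡) chord))
        where
        j₁≡ : i + e ≡ j₀ + suc k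
        j₁≡ = trans (cong (_+ e) (sym j₀+d≡i)) (trans (+-assoc j₀ d e) (cong (j₀ +_) d+e≡))
        j₀<j₁ : j₀ < i + e
        j₀<j₁ = subst (j₀ <_) (sym j₁≡) (m<m+n j₀ (s≤s z≤n))
        conclude : i + e ≡ suc j₀ ⊎ (j₀ ≡ 0 × i + e ≡ m ∸ 1) → m ≡ k + 2
        conclude (inj₁ adjacent) =
          ⊥-elim (<⇒≢ 1≤k (sym (suc-injective
            (+-cancelˡ-≡ j₀ (suc k) 1 (trans (sym j₁≡) (trans adjacent (+-comm 1 j₀)))))))
        conclude (inj₂ (refl , last≡)) = begin
          m              ≡⟨ m≡suc-last ⟨
          suc (m ∸ 1)    ≡⟨ cong suc (trans (sym last≡) j₁≡) ⟩
          suc (suc k)    ≡⟨ +-comm 2 k ⟩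
          k + 2 ∎
          where open ≡-Reasoning

    Old⇒face : (∀ i → i < m → Old (s i)) → Face (n + 2) G m (unlabel ∘ s)
    Old⇒face old =
      3≤m ,
      1≤relabel⇒1≤ (subst (1 ≤_) (sym (back 0 (≤-trans (s≤s z≤n) 3≤m))) 1≤first) ,
      relabel-cancel-≤ (subst₂ _≤_ (sym (back (m ∸ 1) last<m)) (sym (relabel-top n r≤n+1)) last≤) ,
      (λ i 1+i<m → relabel-cancel-< (subst₂ _<_ (sym (back i (<-trans (n<1+n i) 1+i<m))) (sym (back (suc i) 1+i<m))
                                                (step-< i 1+i<m))) ,
      (λ i 1+i<m → Adj-ear-Old⁻ G (old i (<-trans (n<1+n i) 1+i<m)) (old (suc i) 1+i<m) (side i 1+i<m)) ,
      Adj-ear-Old⁻ G (old 0 (≤-trans (s≤s z≤n) 3≤m)) (old (m ∸ 1) last<m) closing ,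
      λ i j i<j j<m h → chordless i j i<j j<m
        (subst₂ (Adj E) (back i (<-trans i<j j<m)) (back j j<m) (Adj-ear-relabel G h))
      where
      back : ∀ i → i < m → relabel k r (unlabel (s i)) ≡ s i
      back i i<m = relabel-unlabel (old i i<m)

  faces-ear : (∀ m s → Face (n + 2) G m s → m ≡ k + 2) → Adj G r (suc r) →
    ∀ m s → Face (n + k + 2) E m s → m ≡ k + 2
  faces-ear facesG edge-r m s F with all-below-or-witness m (λ i → old-or-inserted (s i))
  ... | inj₁ (i , i<m , ins) = EarFace.Inserted⇒k+2 F i i<m ins (Adj-ear-r G edge-r)
  ... | inj₂ old = facesG m (unlabel ∘ s) (EarFace.Old⇒face F old)

fan : ℕ → ℕ → Graph
fan c L = map (λ x → c , suc (c + x)) (upTo L)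

∈-fan⁻ : ∀ {c L x y} → (x , y) ∈ fan c L → x ≡ c × c < y × y ≤ c + L
∈-fan⁻ {c} {L} p with ∈-map⁻ (λ x → c , suc (c + x)) p
... | m , m∈ , refl = refl , s≤s (m≤m+n c m) , subst (_≤ c + L) (+-suc c m) (+-monoʳ-≤ c (∈-upTo⁻ m∈))

∈-fan⁺ : ∀ {c L y} → c < y → y ≤ c + L → (c , y) ∈ fan c L
∈-fan⁺ {c} {L} c<y y≤c+L with m≤n⇒∃[o]m+o≡n c<y
... | m , refl = ∈-map⁺ (λ x → c , suc (c + x))
  (∈-upTo⁺ (+-cancelˡ-≤ c (suc m) L (subst (_≤ c + L) (sym (+-suc c m)) y≤c+L)))

Uncrossed : Graph → ℕ → ℕ → Set
Uncrossed X i j = ∀ c d → Adj X c d → ¬ Cross i j c d × ¬ Cross c d i j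

module EarTriangulation (k r n a : ℕ) (1≤a : 1 ≤ a) (a≤k : a ≤ k) (1≤r : 1 ≤ r) (r≤n+1 : r ≤ n + 1) where
  open Relabelling k r
  1≤k : 1 ≤ k
  1≤k = ≤-trans 1≤a a≤k
  open EarGraph k r 1≤k

  fans : Graph
  fans = fan r a ++ fan (r + a) (suc (k ∸ a))

  earTriangulation : Graph → Graph
  earTriangulation X = ear k r X ++ fans

  EarEdge : ℕ → ℕ → Set
  EarEdge x y = r ≤ x × y ≤ suc (r + k) × x < y × (y ≡ suc x ⊎ (x ≡ r × y ≤ r + a) ⊎ x ≡ r + a)

  r<r+a : r < r + a
  r<r+a = m<m+n r 1≤a

  r+a<r+k+1 : r + a < suc (r + k)
  r+a<r+k+1 = s≤s (+-monoʳ-≤ r a≤k)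

  r+a+[k+1-a] : r + a + suc (k ∸ a) ≡ suc (r + k)
  r+a+[k+1-a] = trans (+-suc (r + a) (k ∸ a)) (cong suc (trans (+-assoc r a (k ∸ a)) (cong (r +_) (m+[n∸m]≡n a≤k))))

  PathEdge⇒EarEdge : ∀ {x y} → PathEdge x y → EarEdge x y
  PathEdge⇒EarEdge (m , m≤k , refl , refl) = m≤m+n r m , s≤s (+-monoʳ-≤ r m≤k) , n<1+n _ , inj₁ refl

  ∈-fans⁻ : ∀ {x y} → (x , y) ∈ fans → EarEdge x y
  ∈-fans⁻ p with ∈-++⁻ (fan r a) p
  ... | inj₁ q with ∈-fan⁻ q
  ... | refl , r<y , y≤r+a = ≤-refl , ≤-trans y≤r+a (<⇒≤ r+a<r+k+1) , r<y , inj₂ (inj₁ (refl , y≤r+a))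
  ∈-fans⁻ p | inj₂ q with ∈-fan⁻ q
  ... | refl , r+a<y , y≤ = m≤m+n r a , ≤-trans y≤ (≤-reflexive r+a+[k+1-a]) , r+a<y , inj₂ (inj₂ refl)

  ear⊆earTriangulation : ∀ X {x y} → Adj (ear k r X) x y → Adj (earTriangulation X) x y
  ear⊆earTriangulation X (inj₁ p) = inj₁ (∈-++⁺ˡ p)
  ear⊆earTriangulation X (inj₂ p) = inj₂ (∈-++⁺ˡ p)

  Adj-earTriangulation⁻ : ∀ X {x y} → Adj (earTriangulation X) x y → ImageEdge X x y ⊎ EarEdge x y ⊎ EarEdge y x
  Adj-earTriangulation⁻ X {x} {y} (inj₁ p) with ∈-++⁻ (ear k r X) p
  ... | inj₂ q = inj₂ (inj₁ (∈-fans⁻ q))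
  ... | inj₁ q with Adj-ear⁻ X {x} {y} (inj₁ q)
  ... | inj₁ image = inj₁ image
  ... | inj₂ (inj₁ path) = inj₂ (inj₁ (PathEdge⇒EarEdge path))
  ... | inj₂ (inj₂ path) = inj₂ (inj₂ (PathEdge⇒EarEdge path))
  Adj-earTriangulation⁻ X {x} {y} (inj₂ p) with ∈-++⁻ (ear k r X) p
  ... | inj₂ q = inj₂ (inj₂ (∈-fans⁻ q))
  ... | inj₁ q with Adj-ear⁻ X {x} {y} (inj₂ q)
  ... | inj₁ image = inj₁ image
  ... | inj₂ (inj₁ path) = inj₂ (inj₁ (PathEdge⇒EarEdge path))
  ... | inj₂ (inj₂ path) = inj₂ (inj₂ (PathEdge⇒EarEdge path))

  EarEdge⇒Adj : ∀ X {x y} → EarEdge x y → Adj (earTriangulation X) x y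
  EarEdge⇒Adj X (r≤x , y≤ , _ , inj₁ refl) with m≤n⇒∃[o]m+o≡n r≤x
  ... | m , refl = ear⊆earTriangulation X (Adj-ear-path X (+-cancelˡ-≤ r m k (≤-pred y≤)))
  EarEdge⇒Adj X (_ , _ , r<y , inj₂ (inj₁ (refl , y≤r+a))) =
    inj₁ (∈-++⁺ʳ (ear k r X) (∈-++⁺ˡ (∈-fan⁺ r<y y≤r+a)))
  EarEdge⇒Adj X (_ , y≤ , r+a<y , inj₂ (inj₂ refl)) =
    inj₁ (∈-++⁺ʳ (ear k r X) (∈-++⁺ʳ (fan r a) (∈-fan⁺ r+a<y (≤-trans y≤ (≤-reflexive (sym r+a+[k+1-a]))))))

  EarEdge-spans-Inserted : ∀ {x y z} → EarEdge x y → x < z → z < y → Inserted z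
  EarEdge-spans-Inserted (r≤x , y≤ , _ , _) x<z z<y = <-≤-trans (s≤s r≤x) x<z , ≤-pred (<-≤-trans z<y y≤)

  EarEdge-Inserted : ∀ {x y} → EarEdge x y → Inserted x ⊎ Inserted y
  EarEdge-Inserted {x} (r≤x , y≤ , x<y , inj₁ refl) with x ≟ r
  ... | yes refl = inj₂ (n<1+n r , subst (_≤ r + k) (+-comm r 1) (+-monoʳ-≤ r 1≤k))
  ... | no x≢r = inj₁ (≤∧≢⇒< r≤x (x≢r ∘ sym) , ≤-pred y≤)
  EarEdge-Inserted (_ , _ , x<y , inj₂ (inj₁ (refl , y≤r+a))) = inj₂ (x<y , ≤-trans y≤r+a (+-monoʳ-≤ r a≤k))
  EarEdge-Inserted (_ , _ , _ , inj₂ (inj₂ refl)) = inj₁ (r<r+a , +-monoʳ-≤ r a≤k)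

  EarEdge-noncrossing : ∀ {w x y z} → EarEdge w x → EarEdge y z → ¬ Cross w x y z
  EarEdge-noncrossing (_ , _ , _ , inj₁ refl) _ (p , q , _) = <⇒≱ q p
  EarEdge-noncrossing _ (_ , _ , _ , inj₁ refl) (_ , q , s) = <⇒≱ s q
  EarEdge-noncrossing (r≤w , _ , _ , _) (_ , _ , _ , inj₂ (inj₁ (refl , _))) (p , _ , _) = <⇒≱ p r≤w
  EarEdge-noncrossing (_ , _ , _ , inj₂ (inj₂ refl)) (_ , _ , _ , inj₂ (inj₂ refl)) (p , _ , _) = <-irrefl refl p
  EarEdge-noncrossing (_ , _ , _ , inj₂ (inj₁ (refl , x≤))) (_ , _ , _ , inj₂ (inj₂ refl)) (_ , q , _) = <⇒≱ q x≤

  ImageEdge-Old : ∀ X {x y} → ImageEdge X x y → Old x × Old y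
  ImageEdge-Old X (c , d , _ , refl , refl) = relabel-Old c , relabel-Old d

  plane-earTriangulation : ∀ X → Plane X → Plane (earTriangulation X)
  plane-earTriangulation X planeX w x y z h₁ h₂ cr@(p , q , s)
    with Adj-earTriangulation⁻ X h₁ | Adj-earTriangulation⁻ X h₂
  ... | inj₂ (inj₂ (_ , _ , x<w , _)) | _ = <-asym x<w (<-trans p q)
  ... | _ | inj₂ (inj₂ (_ , _ , z<y , _)) = <-asym z<y (<-trans q s)
  ... | inj₁ (a₀ , b₀ , ab , refl , refl) | inj₁ (c₀ , d₀ , cd , refl , refl) =
    planeX a₀ b₀ c₀ d₀ ab cd (relabel-Cross⁻ cr)
  ... | inj₁ image | inj₂ (inj₁ ear) = Old⇒¬Inserted (proj₂ (ImageEdge-Old X image)) (EarEdge-spans-Inserted ear q s)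
  ... | inj₂ (inj₁ ear) | inj₁ image = Old⇒¬Inserted (proj₁ (ImageEdge-Old X image)) (EarEdge-spans-Inserted ear p q)
  ... | inj₂ (inj₁ ear) | inj₂ (inj₁ ear′) = EarEdge-noncrossing ear ear′ cr

  plane-ear : ∀ X → Plane X → Plane (ear k r X)
  plane-ear X planeX x y u v h₁ h₂ =
    plane-earTriangulation X planeX x y u v (ear⊆earTriangulation X h₁) (ear⊆earTriangulation X h₂)

  ear⊆earTriangulation-mono : ∀ X Y → (∀ c d → Adj X c d → Adj Y c d) →
    ∀ x y → Adj (ear k r X) x y → Adj (earTriangulation Y) x y
  ear⊆earTriangulation-mono X Y X⊆Y x y = ear⊆earTriangulation Y ∘ ear-mono X Y X⊆Y x y

  chord-earTriangulation : ∀ X → Adj X r (suc r) → Adj (earTriangulation X) r (suc (r + k))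
  chord-earTriangulation X h = ear⊆earTriangulation X (Adj-ear-r X h)

  maximal-inside-ear : ∀ X {i j} → Uncrossed (earTriangulation X) i j → Adj (earTriangulation X) r (suc (r + k)) →
    i < j → r ≤ i → j ≤ suc (r + k) → Adj (earTriangulation X) i j
  maximal-inside-ear X {i} {j} H chord i<j r≤i j≤top with j ≟ suc i
  ... | yes refl = EarEdge⇒Adj X (r≤i , j≤top , i<j , inj₁ refl)
  ... | no j≢1+i with i ≟ r
  ...   | yes refl = from-r
    where
    from-r : Adj (earTriangulation X) r j
    from-r with j ≟ suc (r + k) | j ≤? r + a
    ... | yes refl | _ = chord
    ... | no _ | yes j≤r+a = EarEdge⇒Adj X (≤-refl , j≤top , i<j , inj₂ (inj₁ (refl , j≤r+a)))
    ... | no j≢top | no j≰r+a =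
      ⊥-elim (proj₁ (H (r + a) (suc (r + k)) (EarEdge⇒Adj X (m≤m+n r a , ≤-refl , r+a<r+k+1 , inj₂ (inj₂ refl))))
                    (r<r+a , ≰⇒> j≰r+a , ≤∧≢⇒< j≤top j≢top))
  ...   | no i≢r = elsewhere
    where
    1+i<j : suc i < j
    1+i<j = ≤∧≢⇒< i<j (j≢1+i ∘ sym)
    1+i≤top : suc i ≤ suc (r + k)
    1+i≤top = ≤-trans (<⇒≤ 1+i<j) j≤top
    r<i : r < i
    r<i = ≤∧≢⇒< r≤i (i≢r ∘ sym)
    elsewhere : Adj (earTriangulation X) i j
    elsewhere with <-cmp i (r + a) | j ≤? r + a
    ... | tri≈ _ refl _ | _ = EarEdge⇒Adj X (r≤i , j≤top , i<j , inj₂ (inj₂ refl))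
    ... | tri> _ _ r+a<i | _ =
      ⊥-elim (proj₂ (H (r + a) (suc i) (EarEdge⇒Adj X (m≤m+n r a , 1+i≤top , <-trans r+a<i (n<1+n i) , inj₂ (inj₂ refl))))
                    (r+a<i , n<1+n i , 1+i<j))
    ... | tri< i<r+a _ _ | yes j≤r+a =
      ⊥-elim (proj₂ (H r (suc i) (EarEdge⇒Adj X (≤-refl , 1+i≤top , s≤s r≤i , inj₂ (inj₁ (refl , i<r+a)))))
                    (r<i , n<1+n i , 1+i<j))
    ... | tri< i<r+a _ _ | no j≰r+a =
      ⊥-elim (proj₂ (H r (r + a) (EarEdge⇒Adj X (≤-refl , <⇒≤ r+a<r+k+1 , r<r+a , inj₂ (inj₁ (refl , ≤-refl)))))
                    (r<i , i<r+a , ≰⇒> j≰r+a))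

  maximal-earTriangulation : ∀ X → Maximal (n + 2) X → Adj X r (suc r) → Maximal (n + k + 2) (earTriangulation X)
  maximal-earTriangulation X maximalX edge-r i j 1≤i i<j j≤ H with old-or-inserted i | old-or-inserted j
  ... | inj₁ old-i | inj₁ old-j =
    subst₂ (Adj (earTriangulation X)) (relabel-unlabel old-i) (relabel-unlabel old-j)
      (ear⊆earTriangulation X (Adj-ear-relabel X (maximalX (unlabel i) (unlabel j) 1≤i₀ i₀<j₀ j₀≤ H₀)))
    where
    i₀<j₀ : unlabel i < unlabel j
    i₀<j₀ = relabel-cancel-< (subst₂ _<_ (sym (relabel-unlabel old-i)) (sym (relabel-unlabel old-j)) i<j)
    1≤i₀ : 1 ≤ unlabel i
    1≤i₀ = 1≤relabel⇒1≤ (subst (1 ≤_) (sym (relabel-unlabel old-i)) 1≤i)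
    j₀≤ : unlabel j ≤ n + 2
    j₀≤ = relabel-cancel-≤ (subst₂ _≤_ (sym (relabel-unlabel old-j)) (sym (relabel-top n r≤n+1)) j≤)
    H₀ : Uncrossed X (unlabel i) (unlabel j)
    H₀ c d cd =
      proj₁ uncrossed ∘ subst₂ (λ u v → Cross u v c′ d′) (relabel-unlabel old-i) (relabel-unlabel old-j) ∘ relabel-Cross ,
      proj₂ uncrossed ∘ subst₂ (Cross c′ d′) (relabel-unlabel old-i) (relabel-unlabel old-j) ∘ relabel-Cross
      where
      c′ = relabel k r c
      d′ = relabel k r d
      uncrossed : ¬ Cross i j c′ d′ × ¬ Cross c′ d′ i j
      uncrossed = H c′ d′ (ear⊆earTriangulation X (Adj-ear-relabel X cd))
  ... | inj₂ (r<i , i≤r+k) | _ = maximal-inside-ear X H chord i<j (<⇒≤ r<i) j≤top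
    where
    chord : Adj (earTriangulation X) r (suc (r + k))
    chord = chord-earTriangulation X edge-r
    j≤top : j ≤ suc (r + k)
    j≤top with j ≤? suc (r + k)
    ... | yes p = p
    ... | no p = ⊥-elim (proj₂ (H r (suc (r + k)) chord) (r<i , s≤s i≤r+k , ≰⇒> p))
  ... | inj₁ _ | inj₂ (r<j , j≤r+k) = maximal-inside-ear X H chord i<j r≤i (m≤n⇒m≤1+n j≤r+k)
    where
    chord : Adj (earTriangulation X) r (suc (r + k))
    chord = chord-earTriangulation X edge-r
    r≤i : r ≤ i
    r≤i with r ≤? i
    ... | yes p = p
    ... | no p = ⊥-elim (proj₁ (H r (suc (r + k)) chord) (≰⇒> p , r<j , s≤s j≤r+k))

  valid-earTriangulation : ∀ X → ValidEdges (n + 2) X → ValidEdges (n + k + 2) (earTriangulation X)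
  valid-earTriangulation X validX = All.tabulate valid
    where
    open EarTiling k r n 1≤k 1≤r r≤n+1 X using (valid-ear; r+k<n+k+2)
    valid : ∀ {e} → e ∈ earTriangulation X → ValidEdge (n + k + 2) e
    valid {x , y} p with ∈-++⁻ (ear k r X) p
    ... | inj₁ q = All.lookup (valid-ear validX) q
    ... | inj₂ q with ∈-fans⁻ q
    ... | r≤x , y≤ , x<y , _ = ValidEdge-< (≤-trans 1≤r r≤x) x<y (≤-trans y≤ r+k<n+k+2)

OnInterval : ℕ → ℕ → (ℕ → Set) → Set
OnInterval lo L P = ∀ j → lo ≤ j → j < lo + L → P j

OnInterval-head : ∀ {lo L} {P : ℕ → Set} → OnInterval lo (suc L) P → P lo
OnInterval-head {lo} h = h lo ≤-refl (m<m+n lo (s≤s z≤n))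

OnInterval-tail : ∀ {lo L} {P : ℕ → Set} → OnInterval lo (suc L) P → OnInterval (suc lo) L P
OnInterval-tail {lo} {L} h j lo<j j<lo+L = h j (≤-trans (n≤1+n lo) lo<j) (subst (j <_) (sym (+-suc lo L)) j<lo+L)

count : (ℕ → Bool) → ℕ → ℕ → ℕ
count f lo zero = 0
count f lo (suc L) = (if f lo then 1 else 0) + count f (suc lo) L

count-++ : ∀ f lo A B → count f lo (A + B) ≡ count f lo A + count f (lo + A) B
count-++ f lo zero B rewrite +-identityʳ lo = refl
count-++ f lo (suc A) B rewrite +-suc lo A =
  trans (cong ((if f lo then 1 else 0) +_) (count-++ f (suc lo) A B)) (sym (+-assoc (if f lo then 1 else 0) _ _))

count-shift : ∀ f g lo k L → OnInterval lo L (λ j → f (j + k) ≡ g j) → count f (lo + k) L ≡ count g lo L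
count-shift f g lo k zero _ = refl
count-shift f g lo k (suc L) h =
  cong₂ _+_ (cong (λ b → if b then 1 else 0) (OnInterval-head h)) (count-shift f g (suc lo) k L (OnInterval-tail h))

count-cong : ∀ f g lo L → OnInterval lo L (λ j → f j ≡ g j) → count f lo L ≡ count g lo L
count-cong f g lo zero _ = refl
count-cong f g lo (suc L) h =
  cong₂ _+_ (cong (λ b → if b then 1 else 0) (OnInterval-head h)) (count-cong f g (suc lo) L (OnInterval-tail h))

count-true : ∀ f lo L → OnInterval lo L (λ j → f j ≡ true) → count f lo L ≡ L
count-true f lo zero _ = refl
count-true f lo (suc L) h rewrite OnInterval-head h = cong suc (count-true f (suc lo) L (OnInterval-tail h))

count-false : ∀ f lo L → OnInterval lo L (λ j → f j ≡ false) → count f lo L ≡ 0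
count-false f lo zero _ = refl
count-false f lo (suc L) h rewrite OnInterval-head h = count-false f (suc lo) L (OnInterval-tail h)

length-filter-applyUpTo : ∀ {P : ℕ → Set} (P? : Decidable P) g lo L → (∀ x → g x ≡ lo + x) →
  length (filter P? (applyUpTo g L)) ≡ count (λ j → does (P? j)) lo L
length-filter-applyUpTo P? g lo zero _ = refl
length-filter-applyUpTo P? g lo (suc L) g≡ = trans (length-filter-∷ (g 0) (applyUpTo (g ∘ suc) L))
  (cong₂ _+_ (cong (λ j → if does (P? j) then 1 else 0) (trans (g≡ 0) (+-identityʳ lo)))
             (length-filter-applyUpTo P? (g ∘ suc) (suc lo) L (λ x → trans (g≡ (suc x)) (+-suc lo x))))
  where
  length-filter-∷ : ∀ x xs → length (filter P? (x ∷ xs)) ≡ (if does (P? x) then 1 else 0) + length (filter P? xs)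
  length-filter-∷ x xs with does (P? x)
  ... | true = refl
  ... | false = refl

adj : Graph → ℕ → ℕ → Bool
adj G i j = does (Adj? G i j)

outdeg-count : ∀ N G i L → i + 1 + L ≡ N + 2 → outdeg N G i ≡ count (adj G i) (i + 2) L
outdeg-count N G i L range = trans
  (cong (λ xs → length (filter (λ j → Adj? G i j) xs)) (map-upTo (λ x → i + 2 + x) (N + 2 ∸ (i + 1))))
  (trans (length-filter-applyUpTo (λ j → Adj? G i j) (λ x → i + 2 + x) (i + 2) (N + 2 ∸ (i + 1)) (λ _ → refl))
         (cong (count (adj G i) (i + 2)) (trans (cong (_∸ (i + 1)) (sym range)) (m+n∸m≡n (i + 1) L))))

replicate-snoc : ∀ {A : Set} n (x : A) → replicate n x ++ x ∷ [] ≡ x ∷ replicate n x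
replicate-snoc zero x = refl
replicate-snoc (suc n) x = cong (x ∷_) (replicate-snoc n x)

block : ℕ → List Bool
block d = replicate d true ++ false ∷ []

blocks : (ℕ → ℕ) → ℕ → ℕ → List Bool
blocks d lo zero = []
blocks d lo (suc L) = block (d lo) ++ blocks d (suc lo) L

bits-blocks : ∀ N G → bits N G ≡ blocks (outdeg N G) 1 N
bits-blocks N G = concatMap-blocks (λ x → x) 1 N (λ _ → refl)
  where
  concatMap-blocks : ∀ g lo L → (∀ x → suc (g x) ≡ lo + x) →
    concatMap (λ x → block (outdeg N G (suc x))) (applyUpTo g L) ≡ blocks (outdeg N G) lo L
  concatMap-blocks g lo zero _ = refl
  concatMap-blocks g lo (suc L) g≡ =
    cong₂ _++_ (cong (block ∘ outdeg N G) (trans (g≡ 0) (+-identityʳ lo)))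
               (concatMap-blocks (g ∘ suc) (suc lo) L (λ x → trans (g≡ (suc x)) (+-suc lo x)))

blocks-++ : ∀ d lo A B → blocks d lo (A + B) ≡ blocks d lo A ++ blocks d (lo + A) B
blocks-++ d lo zero B rewrite +-identityʳ lo = refl
blocks-++ d lo (suc A) B rewrite +-suc lo A =
  trans (cong (block (d lo) ++_) (blocks-++ d (suc lo) A B)) (sym (++-assoc (block (d lo)) _ _))

blocks-shift : ∀ d d′ lo k L → OnInterval lo L (λ j → d (j + k) ≡ d′ j) → blocks d (lo + k) L ≡ blocks d′ lo L
blocks-shift d d′ lo k zero _ = refl
blocks-shift d d′ lo k (suc L) h = cong₂ _++_ (cong block (OnInterval-head h)) (blocks-shift d d′ (suc lo) k L (OnInterval-tail h))

blocks-cong : ∀ d d′ lo L → OnInterval lo L (λ j → d j ≡ d′ j) → blocks d lo L ≡ blocks d′ lo L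
blocks-cong d d′ lo zero _ = refl
blocks-cong d d′ lo (suc L) h = cong₂ _++_ (cong block (OnInterval-head h)) (blocks-cong d d′ (suc lo) L (OnInterval-tail h))

blocks-zero : ∀ d lo L → OnInterval lo L (λ j → d j ≡ 0) → blocks d lo L ≡ replicate L false
blocks-zero d lo zero _ = refl
blocks-zero d lo (suc L) h rewrite OnInterval-head h = cong (false ∷_) (blocks-zero d (suc lo) L (OnInterval-tail h))

bitsBefore : ℕ → ℕ → Graph → List Bool
bitsBefore n r T = blocks (outdeg n T) 1 (r ∸ 1) ++ replicate (outdeg n T r) true

p+[k∸p%k]≡[1+p/k]*k : ∀ p k → p + (suc k ∸ p % suc k) ≡ suc (p / suc k) * suc k
p+[k∸p%k]≡[1+p/k]*k p k = begin
  p + (suc k ∸ p % suc k)                     ≡⟨ cong (_+ (suc k ∸ p % suc k)) (m≡m%n+[m/n]*n p (suc k)) ⟩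
  p % suc k + p / suc k * suc k + (suc k ∸ p % suc k) ≡⟨ shuffle (p % suc k) (p / suc k * suc k) (suc k ∸ p % suc k) ⟩
  p % suc k + (suc k ∸ p % suc k) + p / suc k * suc k ≡⟨ cong (_+ p / suc k * suc k) (m+[n∸m]≡n (<⇒≤ (m%n<n p (suc k)))) ⟩
  suc (p / suc k) * suc k ∎
  where
  open ≡-Reasoning
  shuffle : ∀ e Q a → e + Q + a ≡ e + a + Q
  shuffle = solve-∀

module EarOutdegrees (k r n a : ℕ) (1≤a : 1 ≤ a) (a≤k : a ≤ k) (1≤r : 1 ≤ r) (r≤n+1 : r ≤ n + 1)
                     (T : Graph) (edge-r : Adj T r (suc r)) where
  open Relabelling k r
  open EarTriangulation k r n a 1≤a a≤k 1≤r r≤n+1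
  open EarGraph k r 1≤k

  T′ : Graph
  T′ = earTriangulation T

  D D′ : ℕ → ℕ
  D = outdeg n T
  D′ = outdeg (n + k) T′

  Adj-earTriangulation-Old⁻ : ∀ {x y} → Old x → Old y → Adj T′ x y → Adj T (unlabel x) (unlabel y)
  Adj-earTriangulation-Old⁻ {x} {y} old-x old-y h with Adj-earTriangulation⁻ T h
  ... | inj₁ (c , d , cd , refl , refl) = subst₂ (Adj T) (sym (unlabel-relabel c)) (sym (unlabel-relabel d)) cd
  ... | inj₂ (inj₁ ear) = ⊥-elim ([ Old⇒¬Inserted old-x , Old⇒¬Inserted old-y ]′ (EarEdge-Inserted ear))
  ... | inj₂ (inj₂ ear) = ⊥-elim ([ Old⇒¬Inserted old-y , Old⇒¬Inserted old-x ]′ (EarEdge-Inserted ear))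

  adj-relabel : ∀ {c d x y} → relabel k r c ≡ x → relabel k r d ≡ y → adj T′ x y ≡ adj T c d
  adj-relabel {c} {d} refl refl = does-⇔ (mk⇔ back forth) (Adj? T′ (relabel k r c) (relabel k r d)) (Adj? T c d)
    where
    back : Adj T′ (relabel k r c) (relabel k r d) → Adj T c d
    back h = subst₂ (Adj T) (unlabel-relabel c) (unlabel-relabel d) (Adj-earTriangulation-Old⁻ (relabel-Old c) (relabel-Old d) h)
    forth : Adj T c d → Adj T′ (relabel k r c) (relabel k r d)
    forth h = ear⊆earTriangulation T (Adj-ear-relabel T h)

  before-r-¬Adj-Inserted : ∀ {i y} → i < r → Inserted y → ¬ Adj T′ i y
  before-r-¬Adj-Inserted i<r ins h with Adj-earTriangulation⁻ T h
  ... | inj₁ (_ , d , _ , _ , refl) = Old⇒¬Inserted (relabel-Old d) ins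
  ... | inj₂ (inj₁ (r≤i , _)) = <⇒≱ i<r r≤i
  ... | inj₂ (inj₂ (_ , i≤ , y<i , _)) = <⇒≱ (<-trans i<r (proj₁ ins)) (<⇒≤ y<i)

  r-¬Adj-beyond-r+a : ∀ {j} → r + a < j → Inserted j → ¬ Adj T′ r j
  r-¬Adj-beyond-r+a r+a<j ins h with Adj-earTriangulation⁻ T h
  ... | inj₁ (_ , d , _ , _ , refl) = Old⇒¬Inserted (relabel-Old d) ins
  ... | inj₂ (inj₁ (_ , _ , _ , inj₁ refl)) = <⇒≱ r+a<j (≤-trans (≤-reflexive (+-comm 1 r)) (+-monoʳ-≤ r 1≤a))
  ... | inj₂ (inj₁ (_ , _ , _ , inj₂ (inj₁ (_ , j≤r+a)))) = <⇒≱ r+a<j j≤r+a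
  ... | inj₂ (inj₁ (_ , _ , _ , inj₂ (inj₂ r≡r+a))) = <⇒≢ r<r+a r≡r+a
  ... | inj₂ (inj₂ (_ , _ , j<r , _)) = <-asym j<r (proj₁ ins)

  Inserted-¬Adj : ∀ {x j} → Inserted x → suc (suc x) ≤ j → x ≢ r + a ⊎ suc (suc (r + k)) ≤ j → ¬ Adj T′ x j
  Inserted-¬Adj ins x+2≤j cond h with Adj-earTriangulation⁻ T h
  ... | inj₁ (c , _ , _ , refl , _) = Old⇒¬Inserted (relabel-Old c) ins
  ... | inj₂ (inj₂ (_ , _ , j<x , _)) = <-asym j<x (<-trans (n<1+n _) x+2≤j)
  ... | inj₂ (inj₁ (_ , _ , _ , inj₁ refl)) = <-irrefl refl x+2≤j
  ... | inj₂ (inj₁ (_ , _ , _ , inj₂ (inj₁ (refl , _)))) = <-irrefl refl (proj₁ ins)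
  ... | inj₂ (inj₁ (_ , j≤ , _ , inj₂ (inj₂ x≡r+a))) =
    [ (λ x≢ → x≢ x≡r+a) , (λ top<j → <⇒≱ top<j j≤) ]′ cond

  B : ℕ
  B = n + 1 ∸ r

  r+1+B≡n+2 : suc r + B ≡ n + 2
  r+1+B≡n+2 = trans (cong suc (m+[n∸m]≡n r≤n+1)) (sym (+-suc n 1))

  r+1+B+k≡n+k+2 : suc r + B + k ≡ n + k + 2
  r+1+B+k≡n+k+2 = trans (cong (_+ k) r+1+B≡n+2) (shuffle n k)
    where shuffle : ∀ n k → n + 2 + k ≡ n + k + 2
          shuffle = solve-∀

  outdeg-before-r : ∀ i → i < r → D′ i ≡ D i
  outdeg-before-r i i<r = begin
    D′ i                                                      ≡⟨ outdeg-count (n + k) T′ i (A + (k + suc B)) new-range ⟩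
    count f (i + 2) (A + (k + suc B))                         ≡⟨ count-++ f (i + 2) A (k + suc B) ⟩
    count f (i + 2) A + count f (i + 2 + A) (k + suc B)       ≡⟨ cong₂ _+_ below-r (count-++ f (i + 2 + A) k (suc B)) ⟩
    count g (i + 2) A + (count f (i + 2 + A) k + count f (i + 2 + A + k) (suc B))
      ≡⟨ cong₂ (λ u v → count g (i + 2) A + (u + v)) inserted beyond-ear ⟩
    count g (i + 2) A + count g (i + 2 + A) (suc B)           ≡⟨ count-++ g (i + 2) A (suc B) ⟨
    count g (i + 2) (A + suc B)                               ≡⟨ outdeg-count n T i (A + suc B) old-range ⟨
    D i ∎
    where
    open ≡-Reasoning
    f = adj T′ i
    g = adj T i
    A = r ∸ suc i
    i+1+A≡r : suc i + A ≡ r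
    i+1+A≡r = m+[n∸m]≡n i<r
    i+2+A≡r+1 : i + 2 + A ≡ suc r
    i+2+A≡r+1 = trans (shuffle i A) (cong suc i+1+A≡r)
      where shuffle : ∀ i A → i + 2 + A ≡ suc (suc i + A)
            shuffle = solve-∀
    old-range : i + 1 + (A + suc B) ≡ n + 2
    old-range = trans (shuffle i A B) (trans (cong (λ z → suc z + B) i+1+A≡r) r+1+B≡n+2)
      where shuffle : ∀ i A B → i + 1 + (A + suc B) ≡ suc (suc i + A) + B
            shuffle = solve-∀
    new-range : i + 1 + (A + (k + suc B)) ≡ n + k + 2
    new-range = trans (shuffle i A B k) (trans (cong (λ z → suc z + B + k) i+1+A≡r) r+1+B+k≡n+k+2)
      where shuffle : ∀ i A B k → i + 1 + (A + (k + suc B)) ≡ suc (suc i + A) + B + k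
            shuffle = solve-∀
    i≤r : i ≤ r
    i≤r = <⇒≤ i<r
    below-r : count f (i + 2) A ≡ count g (i + 2) A
    below-r = count-cong f g (i + 2) A
      (λ j _ j< → adj-relabel (relabel-≤ i≤r) (relabel-≤ (≤-pred (subst (j <_) i+2+A≡r+1 j<))))
    inserted : count f (i + 2 + A) k ≡ 0
    inserted = count-false f (i + 2 + A) k
      (λ j lo≤j j< → dec-false (Adj? T′ i j)
        (before-r-¬Adj-Inserted i<r (subst (_≤ j) i+2+A≡r+1 lo≤j , ≤-pred (subst (λ z → j < z + k) i+2+A≡r+1 j<))))
    beyond-ear : count f (i + 2 + A + k) (suc B) ≡ count g (i + 2 + A) (suc B)
    beyond-ear = count-shift f g (i + 2 + A) k (suc B)
      (λ j lo≤j _ → adj-relabel (relabel-≤ i≤r) (relabel-> (subst (_≤ j) i+2+A≡r+1 lo≤j)))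

  outdeg-after-ear : ∀ i → r < i → i ≤ n → D′ (i + k) ≡ D i
  outdeg-after-ear i r<i i≤n = begin
    D′ (i + k)                          ≡⟨ outdeg-count (n + k) T′ (i + k) L new-range ⟩
    count (adj T′ (i + k)) (i + k + 2) L ≡⟨ cong (λ z → count (adj T′ (i + k)) z L) (shuffle i k) ⟩
    count (adj T′ (i + k)) (i + 2 + k) L ≡⟨ count-shift (adj T′ (i + k)) (adj T i) (i + 2) k L shifted ⟩
    count (adj T i) (i + 2) L            ≡⟨ outdeg-count n T i L old-range ⟨
    D i ∎
    where
    open ≡-Reasoning
    L = n + 2 ∸ (i + 1)
    old-range : i + 1 + L ≡ n + 2
    old-range = m+[n∸m]≡n (≤-trans (+-monoˡ-≤ 1 i≤n) (+-monoʳ-≤ n (n≤1+n 1)))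
    shuffle : ∀ i k → i + k + 2 ≡ i + 2 + k
    shuffle = solve-∀
    new-range : i + k + 1 + L ≡ n + k + 2
    new-range = trans (shuffle′ i k L) (trans (cong (_+ k) old-range) (shuffle″ n k))
      where shuffle′ : ∀ i k L → i + k + 1 + L ≡ i + 1 + L + k
            shuffle′ = solve-∀
            shuffle″ : ∀ n k → n + 2 + k ≡ n + k + 2
            shuffle″ = solve-∀
    shifted : OnInterval (i + 2) L (λ j → adj T′ (i + k) (j + k) ≡ adj T i j)
    shifted j lo≤j _ = adj-relabel (relabel-> r<i) (relabel-> (<-trans r<i (<-≤-trans (m<m+n i (s≤s z≤n)) lo≤j)))

  outdeg-r : D′ r ≡ a + D r
  outdeg-r = begin
    D′ r                                                   ≡⟨ outdeg-count (n + k) T′ r (a₁ + (c + suc B)) new-range ⟩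
    count f (r + 2) (a₁ + (c + suc B))                     ≡⟨ count-++ f (r + 2) a₁ (c + suc B) ⟩
    count f (r + 2) a₁ + count f (r + 2 + a₁) (c + suc B)  ≡⟨ cong₂ _+_ fan-from-r (count-++ f (r + 2 + a₁) c (suc B)) ⟩
    a₁ + (count f (r + 2 + a₁) c + count f (r + 2 + a₁ + c) (suc B))
      ≡⟨ cong₂ (λ u v → a₁ + (u + count f v (suc B))) beyond-fan end-of-ear ⟩
    a₁ + count f (suc r + k) (suc B)                       ≡⟨ cong (a₁ +_) old-neighbours ⟩
    a₁ + suc (D r)                                         ≡⟨ +-suc a₁ (D r) ⟩
    suc a₁ + D r                                           ≡⟨ cong (_+ D r) a₁+1≡a ⟩
    a + D r ∎
    where
    open ≡-Reasoning
    f = adj T′ r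
    a₁ = a ∸ 1
    c = k ∸ a
    a₁+1≡a : suc a₁ ≡ a
    a₁+1≡a = m+[n∸m]≡n 1≤a
    new-range : r + 1 + (a₁ + (c + suc B)) ≡ n + k + 2
    new-range = trans (shuffle r a₁ c B) (trans (cong (λ z → suc r + B + z) k≡) r+1+B+k≡n+k+2)
      where
      shuffle : ∀ r a₁ c B → r + 1 + (a₁ + (c + suc B)) ≡ suc r + B + (suc a₁ + c)
      shuffle = solve-∀
      k≡ : suc a₁ + c ≡ k
      k≡ = trans (cong (_+ c) a₁+1≡a) (m+[n∸m]≡n a≤k)
    r+2+a₁≡ : r + 2 + a₁ ≡ suc (r + a)
    r+2+a₁≡ = trans (shuffle r a₁) (cong (λ z → suc (r + z)) a₁+1≡a)
      where shuffle : ∀ r a₁ → r + 2 + a₁ ≡ suc (r + suc a₁)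
            shuffle = solve-∀
    end-of-ear : r + 2 + a₁ + c ≡ suc r + k
    end-of-ear = trans (cong (_+ c) r+2+a₁≡) (cong suc (trans (+-assoc r a c) (cong (r +_) (m+[n∸m]≡n a≤k))))
    fan-from-r : count f (r + 2) a₁ ≡ a₁
    fan-from-r = count-true f (r + 2) a₁
      (λ j lo≤j j< → dec-true (Adj? T′ r j)
        (EarEdge⇒Adj T (≤-refl , ≤-trans (≤-pred (subst (j <_) r+2+a₁≡ j<)) (<⇒≤ r+a<r+k+1) ,
                        <-≤-trans (m<m+n r (s≤s z≤n)) lo≤j , inj₂ (inj₁ (refl , ≤-pred (subst (j <_) r+2+a₁≡ j<))))))
    beyond-fan : count f (r + 2 + a₁) c ≡ 0
    beyond-fan = count-false f (r + 2 + a₁) c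
      (λ j lo≤j j< → dec-false (Adj? T′ r j)
        (r-¬Adj-beyond-r+a (subst (_≤ j) r+2+a₁≡ lo≤j)
          (<-≤-trans (s≤s (m≤m+n r a)) (subst (_≤ j) r+2+a₁≡ lo≤j) , ≤-pred (subst (j <_) end-of-ear j<))))
    old-neighbours : count f (suc r + k) (suc B) ≡ suc (D r)
    old-neighbours = begin
      count f (suc r + k) (suc B)
        ≡⟨ count-shift f (adj T r) (suc r) k (suc B) (λ j r<j _ → adj-relabel (relabel-≤ ≤-refl) (relabel-> r<j)) ⟩
      count (adj T r) (suc r) (suc B)
        ≡⟨ cong (λ b → (if b then 1 else 0) + count (adj T r) (suc (suc r)) B) (dec-true (Adj? T r (suc r)) edge-r) ⟩
      suc (count (adj T r) (suc (suc r)) B) ≡⟨ cong (λ z → suc (count (adj T r) z B)) (+-comm 2 r) ⟩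
      suc (count (adj T r) (r + 2) B) ≡⟨ cong suc (outdeg-count n T r B (trans (cong (_+ B) (+-comm r 1)) r+1+B≡n+2)) ⟨
      suc (D r) ∎

  inserted-range : ∀ m → m ≤ k → r + m + 1 + (k ∸ m + B) ≡ n + k + 2
  inserted-range m m≤k = trans (shuffle r m (k ∸ m) B) (trans (cong (λ z → suc r + B + z) (m+[n∸m]≡n m≤k)) r+1+B+k≡n+k+2)
    where shuffle : ∀ r m c B → r + m + 1 + (c + B) ≡ suc r + B + (m + c)
          shuffle = solve-∀

  outdeg-Inserted : ∀ m → 1 ≤ m → m ≤ k → m ≢ a → D′ (r + m) ≡ 0
  outdeg-Inserted m 1≤m m≤k m≢a = trans (outdeg-count (n + k) T′ (r + m) (k ∸ m + B) (inserted-range m m≤k))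
    (count-false (adj T′ (r + m)) (r + m + 2) (k ∸ m + B)
      (λ j lo≤j _ → dec-false (Adj? T′ (r + m) j)
        (Inserted-¬Adj (Inserted-r+ 1≤m m≤k) (subst (_≤ j) (+-comm (r + m) 2) lo≤j) (inj₁ (m≢a ∘ +-cancelˡ-≡ r m a)))))

  outdeg-r+a : D′ (r + a) ≡ k ∸ a
  outdeg-r+a = begin
    D′ (r + a)                                      ≡⟨ outdeg-count (n + k) T′ (r + a) (k ∸ a + B) (inserted-range a a≤k) ⟩
    count (adj T′ (r + a)) (r + a + 2) (k ∸ a + B)   ≡⟨ count-++ (adj T′ (r + a)) (r + a + 2) (k ∸ a) B ⟩
    count (adj T′ (r + a)) (r + a + 2) (k ∸ a) + count (adj T′ (r + a)) (r + a + 2 + (k ∸ a)) B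
      ≡⟨ cong₂ _+_ fan-from-r+a beyond-ear ⟩
    k ∸ a + 0                                        ≡⟨ +-identityʳ (k ∸ a) ⟩
    k ∸ a ∎
    where
    open ≡-Reasoning
    end≡ : r + a + 2 + (k ∸ a) ≡ suc (suc (r + k))
    end≡ = trans (shuffle r a (k ∸ a)) (cong (λ z → suc (suc (r + z))) (m+[n∸m]≡n a≤k))
      where shuffle : ∀ r a c → r + a + 2 + c ≡ suc (suc (r + (a + c)))
            shuffle = solve-∀
    fan-from-r+a : count (adj T′ (r + a)) (r + a + 2) (k ∸ a) ≡ k ∸ a
    fan-from-r+a = count-true (adj T′ (r + a)) (r + a + 2) (k ∸ a)
      (λ j lo≤j j< → dec-true (Adj? T′ (r + a) j)
        (EarEdge⇒Adj T (m≤m+n r a , ≤-pred (subst (j <_) end≡ j<) , <-≤-trans (m<m+n (r + a) (s≤s z≤n)) lo≤j ,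
                        inj₂ (inj₂ refl))))
    beyond-ear : count (adj T′ (r + a)) (r + a + 2 + (k ∸ a)) B ≡ 0
    beyond-ear = count-false (adj T′ (r + a)) (r + a + 2 + (k ∸ a)) B
      (λ j lo≤j _ → dec-false (Adj? T′ (r + a) j)
        (Inserted-¬Adj (Inserted-r+ 1≤a a≤k) (subst (_≤ j) (+-comm (r + a) 2) (≤-trans (m≤m+n (r + a + 2) (k ∸ a)) lo≤j))
                       (inj₂ (subst (_≤ j) end≡ lo≤j))))

  blocks-ear : blocks D′ r (suc k) ≡ replicate (D r) true ++ nests a (k ∸ a) (false ∷ [])
  blocks-ear = begin
    block (D′ r) ++ blocks D′ (suc r) k
      ≡⟨ cong₂ (λ u v → block u ++ blocks D′ (suc r) v) (trans outdeg-r (+-comm a (D r))) k≡ ⟩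
    block (D r + a) ++ blocks D′ (suc r) (a ∸ 1 + suc c)
      ≡⟨ cong (block (D r + a) ++_) (blocks-++ D′ (suc r) (a ∸ 1) (suc c)) ⟩
    block (D r + a) ++ (blocks D′ (suc r) (a ∸ 1) ++ (block (D′ (suc r + (a ∸ 1))) ++ blocks D′ (suc (suc r + (a ∸ 1))) c))
      ≡⟨ cong₂ (λ u v → block (D r + a) ++ (u ++ v)) (blocks-zero D′ (suc r) (a ∸ 1) before-r+a)
                 (cong₂ _++_ (cong block (trans (cong D′ r+a≡) outdeg-r+a))
                             (blocks-zero D′ (suc (suc r + (a ∸ 1))) c after-r+a)) ⟩
    block (D r + a) ++ (replicate (a ∸ 1) false ++ (block c ++ replicate c false))
      ≡⟨ cong (λ z → block (D r + z) ++ (replicate (a ∸ 1) false ++ (block c ++ replicate c false))) (sym a≡) ⟩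
    block (D r + suc (a ∸ 1)) ++ (replicate (a ∸ 1) false ++ (block c ++ replicate c false))
      ≡⟨ layout (D r) (a ∸ 1) ⟩
    replicate (D r) true ++ nests (suc (a ∸ 1)) c (false ∷ [])
      ≡⟨ cong (λ z → replicate (D r) true ++ nests z c (false ∷ [])) a≡ ⟩
    replicate (D r) true ++ nests a c (false ∷ []) ∎
    where
    open ≡-Reasoning
    c = k ∸ a
    a≡ : suc (a ∸ 1) ≡ a
    a≡ = m+[n∸m]≡n 1≤a
    k≡ : k ≡ a ∸ 1 + suc c
    k≡ = trans (sym (m+[n∸m]≡n a≤k)) (trans (cong (_+ c) (sym a≡)) (sym (+-suc (a ∸ 1) c)))
    r+a≡ : suc r + (a ∸ 1) ≡ r + a
    r+a≡ = trans (sym (+-suc r (a ∸ 1))) (cong (r +_) a≡)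
    inserted : ∀ j → suc r ≤ j → j ≤ r + k → D′ j ≡ 0 ⊎ j ≡ r + a
    inserted j r<j j≤r+k with j ≟ r + a
    ... | yes j≡ = inj₂ j≡
    ... | no j≢ = inj₁ (subst (λ z → D′ z ≡ 0) (m+[n∸m]≡n (<⇒≤ r<j))
                    (outdeg-Inserted (j ∸ r) (m<n⇒0<n∸m r<j) (subst (j ∸ r ≤_) (m+n∸m≡n r k) (∸-monoˡ-≤ r j≤r+k))
                      (λ j-r≡a → j≢ (trans (sym (m+[n∸m]≡n (<⇒≤ r<j))) (cong (r +_) j-r≡a)))))
    before-r+a : OnInterval (suc r) (a ∸ 1) (λ j → D′ j ≡ 0)
    before-r+a j r<j j< with inserted j r<j (≤-trans (<⇒≤ (subst (j <_) r+a≡ j<)) (+-monoʳ-≤ r a≤k))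
    ... | inj₁ D′j≡0 = D′j≡0
    ... | inj₂ refl = ⊥-elim (<-irrefl (sym r+a≡) j<)
    after-r+a : OnInterval (suc (suc r + (a ∸ 1))) c (λ j → D′ j ≡ 0)
    after-r+a j lo≤j j<
      with inserted j (<-≤-trans (s≤s (m≤m+n r (a ∸ 1))) (≤-trans (n≤1+n _) lo≤j)) (≤-pred (subst (j <_) end≡ j<))
      where
      end≡ : suc (suc r + (a ∸ 1)) + c ≡ suc (r + k)
      end≡ = cong suc (trans (cong (_+ c) r+a≡) (trans (+-assoc r a c) (cong (r +_) (m+[n∸m]≡n a≤k))))
    ... | inj₁ D′j≡0 = D′j≡0
    ... | inj₂ refl = ⊥-elim (<-irrefl r+a≡ lo≤j)
    layout : ∀ d a₁ → block (d + suc a₁) ++ (replicate a₁ false ++ (block c ++ replicate c false)) ≡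
                      replicate d true ++ nests (suc a₁) c (false ∷ [])
    layout (suc d) a₁ = cong (true ∷_) (layout d a₁)
    layout zero a₁ = trans (++-assoc (replicate (suc a₁) true) (false ∷ []) _)
      (cong (λ z → replicate (suc a₁) true ++ false ∷ replicate a₁ false ++ z) (begin
      (replicate c true ++ false ∷ []) ++ replicate c false ≡⟨ ++-assoc (replicate c true) (false ∷ []) (replicate c false) ⟩
      replicate c true ++ false ∷ replicate c false        ≡⟨ cong (replicate c true ++_) (replicate-snoc c false) ⟨
      replicate c true ++ replicate c false ++ false ∷ [] ∎))

  prefix : List Bool
  prefix = bitsBefore n r T

  blocks-through-ear : blocks D′ 1 (r ∸ 1 + suc k) ≡ prefix ++ nests a (k ∸ a) (false ∷ [])
  blocks-through-ear = begin
    blocks D′ 1 (r ∸ 1 + suc k)                           ≡⟨ blocks-++ D′ 1 (r ∸ 1) (suc k) ⟩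
    blocks D′ 1 (r ∸ 1) ++ blocks D′ (1 + (r ∸ 1)) (suc k)
      ≡⟨ cong₂ (λ u v → u ++ blocks D′ v (suc k)) before-r r-1+1≡r ⟩
    blocks D 1 (r ∸ 1) ++ blocks D′ r (suc k)             ≡⟨ cong (blocks D 1 (r ∸ 1) ++_) blocks-ear ⟩
    blocks D 1 (r ∸ 1) ++ replicate (D r) true ++ nests a (k ∸ a) (false ∷ []) ≡⟨ ++-assoc (blocks D 1 (r ∸ 1)) _ _ ⟨
    prefix ++ nests a (k ∸ a) (false ∷ []) ∎
    where
    open ≡-Reasoning
    r-1+1≡r : 1 + (r ∸ 1) ≡ r
    r-1+1≡r = m+[n∸m]≡n 1≤r
    before-r : blocks D′ 1 (r ∸ 1) ≡ blocks D 1 (r ∸ 1)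
    before-r = blocks-cong D′ D 1 (r ∸ 1) (λ j _ j< → outdeg-before-r j (subst (j <_) r-1+1≡r j<))

  -- When r = n + 1, p_r has no block in the old sequence and p_{r+k} has none in the new one,
  -- so the new sequence is compared after appending the empty block of p_{r+k}.
  bits-decomposition : Σ (List Bool) λ rest →
    bits n T ≡ prefix ++ rest × bits (n + k) T′ ≡ prefix ++ nests a (k ∸ a) rest
  bits-decomposition with m≤n⇒m<n∨m≡n r≤n+1
  ... | inj₁ r<n+1 = false ∷ blocks D (suc r) (n ∸ r) , old , new
    where
    open ≡-Reasoning
    r≤n : r ≤ n
    r≤n = ≤-pred (subst (r <_) (+-comm n 1) r<n+1)
    Post = blocks D (suc r) (n ∸ r)
    n≡ : r ∸ 1 + suc (n ∸ r) ≡ n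
    n≡ = trans (+-suc (r ∸ 1) (n ∸ r)) (trans (cong (_+ (n ∸ r)) (m+[n∸m]≡n 1≤r)) (m+[n∸m]≡n r≤n))
    old : bits n T ≡ prefix ++ false ∷ Post
    old = begin
      bits n T                                                  ≡⟨ bits-blocks n T ⟩
      blocks D 1 n                                              ≡⟨ cong (blocks D 1) n≡ ⟨
      blocks D 1 (r ∸ 1 + suc (n ∸ r))                          ≡⟨ blocks-++ D 1 (r ∸ 1) (suc (n ∸ r)) ⟩
      blocks D 1 (r ∸ 1) ++ blocks D (1 + (r ∸ 1)) (suc (n ∸ r))
        ≡⟨ cong (λ z → blocks D 1 (r ∸ 1) ++ blocks D z (suc (n ∸ r))) (m+[n∸m]≡n 1≤r) ⟩
      blocks D 1 (r ∸ 1) ++ (replicate (D r) true ++ false ∷ []) ++ Post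
        ≡⟨ cong (blocks D 1 (r ∸ 1) ++_) (++-assoc (replicate (D r) true) (false ∷ []) Post) ⟩
      blocks D 1 (r ∸ 1) ++ replicate (D r) true ++ false ∷ Post ≡⟨ ++-assoc (blocks D 1 (r ∸ 1)) _ _ ⟨
      prefix ++ false ∷ Post ∎
    after-ear : blocks D′ (1 + (r ∸ 1 + suc k)) (n ∸ r) ≡ Post
    after-ear = trans (cong (λ z → blocks D′ z (n ∸ r)) start≡)
      (blocks-shift D′ D (suc r) k (n ∸ r)
        (λ j r<j j< → outdeg-after-ear j r<j (≤-pred (subst (j <_) (cong suc (m+[n∸m]≡n r≤n)) j<))))
      where
      start≡ : 1 + (r ∸ 1 + suc k) ≡ suc r + k
      start≡ = trans (cong suc (+-suc (r ∸ 1) k)) (cong (λ z → suc z + k) (m+[n∸m]≡n 1≤r))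
    new : bits (n + k) T′ ≡ prefix ++ nests a (k ∸ a) (false ∷ Post)
    new = begin
      bits (n + k) T′                        ≡⟨ bits-blocks (n + k) T′ ⟩
      blocks D′ 1 (n + k)                    ≡⟨ cong (blocks D′ 1) (trans (shuffle (r ∸ 1) k (n ∸ r)) (cong (_+ k) n≡)) ⟨
      blocks D′ 1 (r ∸ 1 + suc k + (n ∸ r))  ≡⟨ blocks-++ D′ 1 (r ∸ 1 + suc k) (n ∸ r) ⟩
      blocks D′ 1 (r ∸ 1 + suc k) ++ blocks D′ (1 + (r ∸ 1 + suc k)) (n ∸ r) ≡⟨ cong₂ _++_ blocks-through-ear after-ear ⟩
      (prefix ++ nests a (k ∸ a) (false ∷ [])) ++ Post ≡⟨ ++-assoc prefix _ Post ⟩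
      prefix ++ nests a (k ∸ a) (false ∷ []) ++ Post   ≡⟨ cong (prefix ++_) (nests-++ a (k ∸ a) (false ∷ []) Post) ⟩
      prefix ++ nests a (k ∸ a) (false ∷ Post) ∎
      where shuffle : ∀ x k y → x + suc k + y ≡ x + suc y + k
            shuffle = solve-∀
  ... | inj₂ r≡n+1 = [] , old , ∷ʳ-injectiveˡ (bits (n + k) T′) (prefix ++ nests a (k ∸ a) []) new
    where
    open ≡-Reasoning
    n≡ : n ≡ r ∸ 1
    n≡ = sym (trans (cong (_∸ 1) r≡n+1) (m+n∸n≡m n 1))
    last-empty : D r ≡ 0
    last-empty = outdeg-count n T r 0 (trans (+-identityʳ (r + 1)) (trans (cong (_+ 1) r≡n+1) (+-assoc n 1 1)))
    old : bits n T ≡ prefix ++ []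
    old = begin
      bits n T                        ≡⟨ bits-blocks n T ⟩
      blocks D 1 n                    ≡⟨ cong (blocks D 1) n≡ ⟩
      blocks D 1 (r ∸ 1)              ≡⟨ ++-identityʳ _ ⟨
      blocks D 1 (r ∸ 1) ++ replicate 0 true ≡⟨ cong (λ z → blocks D 1 (r ∸ 1) ++ replicate z true) last-empty ⟨
      prefix                          ≡⟨ ++-identityʳ prefix ⟨
      prefix ++ [] ∎
    r+k-empty : D′ (r + k) ≡ 0
    r+k-empty with k ≟ a
    ... | yes refl = trans outdeg-r+a (n∸n≡0 k)
    ... | no k≢a = outdeg-Inserted k 1≤k ≤-refl k≢a
    new : bits (n + k) T′ ++ false ∷ [] ≡ (prefix ++ nests a (k ∸ a) []) ++ false ∷ []
    new = begin
      bits (n + k) T′ ++ false ∷ []                      ≡⟨ cong (_++ false ∷ []) (bits-blocks (n + k) T′) ⟩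
      blocks D′ 1 (n + k) ++ block 0                     ≡⟨ cong (λ z → blocks D′ 1 (n + k) ++ block z) r+k-empty ⟨
      blocks D′ 1 (n + k) ++ block (D′ (r + k))           ≡⟨ cong (λ z → blocks D′ 1 (n + k) ++ z) (sym (++-identityʳ _)) ⟩
      blocks D′ 1 (n + k) ++ blocks D′ (r + k) 1          ≡⟨ cong (λ z → blocks D′ 1 (n + k) ++ blocks D′ z 1) r+k≡ ⟩
      blocks D′ 1 (n + k) ++ blocks D′ (1 + (n + k)) 1    ≡⟨ blocks-++ D′ 1 (n + k) 1 ⟨
      blocks D′ 1 (n + k + 1)                            ≡⟨ cong (blocks D′ 1) (trans (shuffle n k) (cong (_+ suc k) n≡)) ⟩
      blocks D′ 1 (r ∸ 1 + suc k)                        ≡⟨ blocks-through-ear ⟩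
      prefix ++ nests a (k ∸ a) (false ∷ [])              ≡⟨ cong (prefix ++_) (nests-++ a (k ∸ a) [] (false ∷ [])) ⟨
      prefix ++ nests a (k ∸ a) [] ++ false ∷ []          ≡⟨ ++-assoc prefix _ _ ⟨
      (prefix ++ nests a (k ∸ a) []) ++ false ∷ [] ∎
      where
      r+k≡ : r + k ≡ 1 + (n + k)
      r+k≡ = trans (cong (_+ k) (trans r≡n+1 (+-comm n 1))) (+-assoc 1 n k)
      shuffle : ∀ n k → n + k + 1 ≡ n + suc k
      shuffle = solve-∀

  KValidTri-earTriangulation : ∀ q → length prefix + a ≡ suc q * k → KValidTri k n T → KValidTri k (n + k) T′
  KValidTri-earTriangulation q aligned validT l j mem with bits-decomposition
  ... | rest , old , new =
    scan-nests-monochromatic k q a (k ∸ a) prefix rest 1≤k aligned (m+[n∸m]≡n a≤k)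
      (subst (λ bs → Monochromatic k (scan bs 1 [])) old validT) l j
      (subst (λ bs → (l , j) ∈ scan bs 1 []) new mem)

lemma3 : (k n : ℕ) → 2 ≤ k → 1 ≤ n → k ∣ n →
           (G : Graph) → KValidTiling k (k + 2) n G →
           (r : ℕ) → 1 ≤ r → r ≤ n + 1 →
           KValidTiling k (k + 2) (n + k) (ear k r G)
lemma3 (suc k) n (s≤s _) _ _ G (((validG , planeG) , hullG , facesG) , T , (((validT , planeT) , maximalT) , G⊆T , kvalidT))
       r 1≤r r≤n+1 =
  ((valid-ear validG , plane-ear G planeG) , hull-ear hullG , faces-ear facesG edge-r) ,
  earTriangulation T ,
  ((valid-earTriangulation T validT , plane-earTriangulation T planeT) , maximal-earTriangulation T maximalT edge-r′) ,
  ear⊆earTriangulation-mono G T G⊆T ,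
  KValidTri-earTriangulation (length P / suc k) (p+[k∸p%k]≡[1+p/k]*k (length P) k) kvalidT
  where
  P = bitsBefore n r T
  a = suc k ∸ length P % suc k
  1≤a : 1 ≤ a
  1≤a = m<n⇒0<n∸m (m%n<n (length P) (suc k))
  edge-r : Adj G r (suc r)
  edge-r = proj₁ hullG r 1≤r (≤-trans (s≤s r≤n+1) (≤-reflexive (sym (+-suc n 1))))
  edge-r′ : Adj T r (suc r)
  edge-r′ = G⊆T r (suc r) edge-r
  open EarTiling (suc k) r n (s≤s z≤n) 1≤r r≤n+1 G using (valid-ear; hull-ear; faces-ear)
  a≤k : a ≤ suc k
  a≤k = m∸n≤m (suc k) (length P % suc k)
  open EarTriangulation (suc k) r n a 1≤a a≤k 1≤r r≤n+1
    using (earTriangulation; plane-ear; ear⊆earTriangulation-mono; valid-earTriangulation;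
           plane-earTriangulation; maximal-earTriangulation)
  open EarOutdegrees (suc k) r n a 1≤a a≤k 1≤r r≤n+1 T edge-r′ using (KValidTri-earTriangulation)
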